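{- Let $k\ge1$, $c\in\{0,\dots,k\}$, let $\lambda$ be a partition contained in $R=(c^{k+1-c})$ with conjugate $\lambda'$, and let $x=(i,j)$ be a cell of $\lambda$. Then \[ w_{\lambda\setminus\{x\}}=w_{\lambda_x}\,\Gamma_{\lambda,x},\qquad \Gamma_{\lambda,x}=\big(s_{\lambda_i-1}s_{\lambda_i-2}\cdots s_{j+1}s_j\big)\big(s_{ -\lambda'_j+1}s_{ -\lambda'_j+2}\cdots s_{ -i}\big), \] (where a product whose first index is smaller than its last in the first factor, resp. larger in the second, is empty), as elements of $W$.
   Context: Affine symmetric group $W$: bijections $w:\mathbb Z\to\mathbb Z$ with $w(m+k+1)=w(m)+k+1$ and $\sum_{m=1}^{k+1}w(m)=\sum_{m=1}^{k+1}m$; for $r\in\{0,\dots,k\}$, $s_r$ exchanges $r+t(k+1)$ and $r+1+t(k+1)$ for all $t$; for any integer $a$, $s_a:=s_{a\bmod(k+1)}$. Diagrams: cell $(p,q)$ in row $p$ (from top), column $q$ (from left), residue $(q-p)\bmod(k+1)$. For a set $\mathcal D$ of cells, $w_{\mathcal D}=s_{r_1}\cdots s_{r_m}$ where $r_1,\dots,r_m$ are the residues read starting in the bottom row, each row right to left, rows bottom to top; $w_\mu$ is this for the diagram of a partition $\mu$. The hook $\mathcal H_x$ of $x=(i,j)$ consists of $x$, the cells of $\lambda$ directly to its right in row $i$, and the cells of $\lambda$ directly below it in column $j$. $\lambda_x$ is the partition obtained from the diagram $\lambda\setminus\mathcal H_x$ by moving every cell $(p,q)$ with $p>i$ and $q>j$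 to $(p-1,q-1)$ (cells not below-right of $x$ stay in place); equivalently its row lengths are $\lambda_p$ for $p<i$ and $\min(\lambda_p,j-1)+\max(\lambda_{p+1}-j,0)$ for $p\ge i$. -}

module Defs where

open import Data.Nat as ℕ using (ℕ; zero; suc; _⊓_; _∸_)
open import Data.Nat.DivMod using (_%_)
open import Data.Integer as ℤ using (ℤ; +_; -_; _%ℕ_)
open import Data.Bool using (Bool; true; false; if_then_else_; _∧_; not)
open import Data.List using (List; []; _∷_; _++_; length; filter)
open import Relation.Nullary.Decidable using (yes; no)

-- The affine symmetric group W for a fixed k (period n = k+1), realised
-- as bijections ℤ → ℤ; the product uv is composition u ∘ v.

-- s_a for an arbitrary integer a, i.e. s_{a mod (k+1)}: exchanges
-- r + t(k+1) and r+1 + t(k+1) for all t, where r = a mod (k+1).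
s : (k : ℕ) → ℤ → ℤ → ℤ
s k a m with m %ℕ suc k ℕ.≟ a %ℕ suc k
... | yes _ = m ℤ.+ ℤ.1ℤ
... | no _ with m %ℕ suc k ℕ.≟ (suc (a %ℕ suc k)) % suc k
...   | yes _ = m ℤ.- ℤ.1ℤ
...   | no _ = m

act : (k : ℕ) → List ℤ → ℤ → ℤ
act k [] m = m
act k (a ∷ w) m = s k a (act k w m)

-- Diagrams. A (finite) set of cells is a Boolean predicate on cells
-- (p , q) (row p, column q, 1-indexed) together with a bounding box
-- rows 1..N, columns 1..M containing all its cells.

residue : (k p q : ℕ) → ℤ
residue k p q = + ((+ q ℤ.- + p) %ℕ suc k)

-- row p read right to left (columns M, M-1, …, 1)
readRow : (k : ℕ) → (ℕ → ℕ → Bool) → (p M : ℕ) → List ℤ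
readRow k D p zero = []
readRow k D p (suc q) =
  (if D p (suc q) then residue k p (suc q) ∷ [] else []) ++ readRow k D p q

-- rows read bottom to top (rows N, N-1, …, 1)
readDiag : (k : ℕ) → (ℕ → ℕ → Bool) → (N M : ℕ) → List ℤ
readDiag k D zero M = []
readDiag k D (suc p) M = readRow k D (suc p) M ++ readDiag k D p M

wDiag : (k : ℕ) → (ℕ → ℕ → Bool) → (N M : ℕ) → ℤ → ℤ
wDiag k D N M = act k (readDiag k D N M)

-- Partitions, given as lists of row lengths (λ₁, λ₂, …).

-- λ_p (1-indexed; 0 outside)
row : List ℕ → ℕ → ℕ
row la zero = 0
row [] (suc p) = 0
row (a ∷ la) (suc zero) = a
row (a ∷ la) (suc (suc p)) = row la (suc p)

conj : List ℕ → ℕ → ℕ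
conj la j = length (filter (λ a → j ℕ.≤? a) la)

diagOf : (ℕ → ℕ) → ℕ → ℕ → Bool
diagOf μ p q = (1 ℕ.≤ᵇ p) ∧ (1 ℕ.≤ᵇ q) ∧ (q ℕ.≤ᵇ μ p)

diagMinus : List ℕ → (i j : ℕ) → ℕ → ℕ → Bool
diagMinus la i j p q = diagOf (row la) p q ∧ not ((p ℕ.≡ᵇ i) ∧ (q ℕ.≡ᵇ j))

rowLx : List ℕ → (i j : ℕ) → ℕ → ℕ
rowLx la i j p =
  if p ℕ.<ᵇ i then row la p
  else (row la p ⊓ (j ∸ 1)) ℕ.+ (row la (suc p) ∸ j)

stepDown : ℤ → ℕ → List ℤ
stepDown a zero = []
stepDown a (suc t) = a ∷ stepDown (a ℤ.- ℤ.1ℤ) t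

stepUp : ℤ → ℕ → List ℤ
stepUp a zero = []
stepUp a (suc t) = a ∷ stepUp (a ℤ.+ ℤ.1ℤ) t

rangeDown : ℤ → ℤ → List ℤ
rangeDown a b = if b ℤ.≤ᵇ a then stepDown a (suc ℤ.∣ a ℤ.- b ∣) else []

rangeUp : ℤ → ℤ → List ℤ
rangeUp a b = if a ℤ.≤ᵇ b then stepUp a (suc ℤ.∣ b ℤ.- a ∣) else []

Γword : List ℕ → (i j : ℕ) → List ℤ
Γword la i j =
  rangeDown (+ row la i ℤ.- ℤ.1ℤ) (+ j)
  ++ rangeUp (- (+ conj la j) ℤ.+ ℤ.1ℤ) (- (+ i))

-- Reading the diagrams row by row, λ ∖ {x} and λ_x differ only in the rows i, …, a,
-- where a = λ'_j. Write the reading word of a row p ≤ a as U_p s_{j−p} V_p, splitting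
-- it at column j. The hole left by x is slid down column j using only commutations
-- of far generators and braid relations: at each step the cell (p+1, j) fills the
-- hole, U_{p+1} joins V_p to form row p of λ_x, and one generator s_{−p} is pushed out
-- to the right. Once the hole has left row a, these generators form the second factor
-- s_{1−a} ⋯ s_{−i} of Γ, while U_i, moved to the right end through the (longer) rows
-- above row i, has every index raised by i − 1 and becomes the first factor
-- s_{λ_i−1} ⋯ s_j.
-- Since λ fits in the (k+1−c) × c rectangle, all indices meeting in one of these
-- relations differ by less than k, so nothing wraps around modulo k + 1.

module Submission where

open import Defs
open import Algebra.Bundles using (Monoid)
import Algebra.Solver.Monoid
open import Data.Bool using (Bool; true; false; T; _∧_; not)
open import Data.Bool.Properties using (T-≡; ¬-not; ∧-identityʳ)
open import Data.Integer as ℤ using (ℤ; +_)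
open import Data.Integer.DivMod using (a≡a%ℕn+[a/ℕn]*n; n%ℕd<d)
import Data.Integer.Properties as ℤP
open import Data.Integer.Tactic.RingSolver using (solve-∀)
open import Data.List using (List; []; _∷_; _++_; [_]; length)
open import Data.List.Properties using (++-assoc; ++-identityʳ; length-filter)
open import Data.List.Relation.Unary.All using (All; []; _∷_)
open import Data.List.Relation.Unary.Linked as Linked using (Linked; _∷_)
open import Data.Nat as ℕ using (ℕ; zero; suc; _≤_; _<_; _≥_; _∸_; z≤n; s≤s)
open import Data.Nat.DivMod using (_%_; _/_; m≡m%n+[m/n]*n; m%n<n; m<n⇒m%n≡m; n%n≡0; m≤n⇒[n∸m]%m≡n%m)
import Data.Nat.Properties as ℕP
open import Data.Product using (_×_; _,_; Σ)
open import Data.Sum using (_⊎_; inj₁; inj₂)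
open import Function.Bundles using (Equivalence)
open import Relation.Binary.PropositionalEquality hiding ([_])
import Relation.Binary.Reasoning.Setoid
open import Relation.Nullary using (¬_; yes; no; contradiction)

module Residue (k : ℕ) where

  n : ℕ
  n = suc k

  res : ℤ → ℕ
  res z = z ℤ.%ℕ n

  sucMod : ℕ → ℕ
  sucMod r = suc r % n

  res<n : ∀ z → res z < n
  res<n z = n%ℕd<d z n

  private
    multiple<n⇒0 : ∀ q r → q ℕ.* n ≡ r → r < n → q ≡ 0
    multiple<n⇒0 zero    r _  _   = refl
    multiple<n⇒0 (suc q) r eq r<n =
      contradiction (ℕP.≤-trans (ℕP.m≤m+n n (q ℕ.* n)) (ℕP.≤-reflexive eq)) (ℕP.<⇒≱ r<n)

  remainder-unique : ∀ r r' (q q' : ℤ) → r < n → r' < n →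
                     + r ℤ.+ q ℤ.* + n ≡ + r' ℤ.+ q' ℤ.* + n → r ≡ r'
  remainder-unique r r' q q' r<n r'<n eq = ℤP.+-injective (ℤP.i-j≡0⇒i≡j (+ r) (+ r') r-r'≡0)
    where
    r-r'≡[q'-q]n : + r ℤ.- + r' ≡ (q' ℤ.- q) ℤ.* + n
    r-r'≡[q'-q]n = begin
      + r ℤ.- + r'                                    ≡⟨ cancel (+ r) (+ r') q (+ n) ⟩
      (+ r ℤ.+ q ℤ.* + n) ℤ.- (+ r' ℤ.+ q ℤ.* + n)    ≡⟨ cong (ℤ._- (+ r' ℤ.+ q ℤ.* + n)) eq ⟩
      (+ r' ℤ.+ q' ℤ.* + n) ℤ.- (+ r' ℤ.+ q ℤ.* + n)  ≡⟨ collect (+ r') q q' (+ n) ⟩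
      (q' ℤ.- q) ℤ.* + n                              ∎
      where
      open ≡-Reasoning
      cancel : ∀ a b c d → a ℤ.- b ≡ (a ℤ.+ c ℤ.* d) ℤ.- (b ℤ.+ c ℤ.* d)
      cancel = solve-∀
      collect : ∀ a b c d → (a ℤ.+ c ℤ.* d) ℤ.- (a ℤ.+ b ℤ.* d) ≡ (c ℤ.- b) ℤ.* d
      collect = solve-∀
    ∣r-r'∣<n : ℤ.∣ + r ℤ.- + r' ∣ < n
    ∣r-r'∣<n = ℕP.≤-<-trans (ℕP.≤-trans (ℕP.≤-reflexive (cong ℤ.∣_∣ (ℤP.m-n≡m⊖n r r'))) (ℤP.∣m⊝n∣≤m⊔n r r'))
                 (ℕP.⊔-lub r<n r'<n)
    q'-q≡0 : q' ℤ.- q ≡ + 0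
    q'-q≡0 = ℤP.∣i∣≡0⇒i≡0 (multiple<n⇒0 _ _
      (trans (sym (ℤP.abs-* (q' ℤ.- q) (+ n))) (cong ℤ.∣_∣ (sym r-r'≡[q'-q]n))) ∣r-r'∣<n)
    r-r'≡0 : + r ℤ.- + r' ≡ + 0
    r-r'≡0 = trans r-r'≡[q'-q]n (trans (cong (ℤ._* + n) q'-q≡0) (ℤP.*-zeroˡ (+ n)))

  res-unique : ∀ z r (q : ℤ) → r < n → z ≡ + r ℤ.+ q ℤ.* + n → res z ≡ r
  res-unique z r q r<n eq =
    remainder-unique (res z) r (z ℤ./ℕ n) q (res<n z) r<n (trans (sym (a≡a%ℕn+[a/ℕn]*n z n)) eq)

  res-+ : ∀ z d → res (z ℤ.+ + d) ≡ (res z ℕ.+ d) % n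
  res-+ z d = res-unique (z ℤ.+ + d) (R % n) (+ (R / n) ℤ.+ z ℤ./ℕ n) (m%n<n R n) eq
    where
    open ≡-Reasoning
    R : ℕ
    R = res z ℕ.+ d
    R≡ : + R ≡ + (R % n) ℤ.+ + (R / n) ℤ.* + n
    R≡ = trans (cong +_ (m≡m%n+[m/n]*n R n))
           (trans (ℤP.pos-+ (R % n) ((R / n) ℕ.* n)) (cong (λ v → + (R % n) ℤ.+ v) (ℤP.pos-* (R / n) n)))
    swap : ∀ a b c e → (a ℤ.+ b ℤ.* c) ℤ.+ e ≡ (a ℤ.+ e) ℤ.+ b ℤ.* c
    swap = solve-∀
    collect : ∀ a b c e → (a ℤ.+ b ℤ.* e) ℤ.+ c ℤ.* e ≡ a ℤ.+ (b ℤ.+ c) ℤ.* e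
    collect = solve-∀
    eq : z ℤ.+ + d ≡ + (R % n) ℤ.+ (+ (R / n) ℤ.+ z ℤ./ℕ n) ℤ.* + n
    eq = begin
      z ℤ.+ + d                                               ≡⟨ cong (ℤ._+ + d) (a≡a%ℕn+[a/ℕn]*n z n) ⟩
      (+ res z ℤ.+ z ℤ./ℕ n ℤ.* + n) ℤ.+ + d                   ≡⟨ swap (+ res z) (z ℤ./ℕ n) (+ n) (+ d) ⟩
      (+ res z ℤ.+ + d) ℤ.+ z ℤ./ℕ n ℤ.* + n                   ≡⟨ cong (ℤ._+ z ℤ./ℕ n ℤ.* + n) (trans (sym (ℤP.pos-+ (res z) d)) R≡) ⟩
      (+ (R % n) ℤ.+ + (R / n) ℤ.* + n) ℤ.+ z ℤ./ℕ n ℤ.* + n   ≡⟨ collect (+ (R % n)) (+ (R / n)) (z ℤ./ℕ n) (+ n) ⟩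
      + (R % n) ℤ.+ (+ (R / n) ℤ.+ z ℤ./ℕ n) ℤ.* + n           ∎

  res-suc : ∀ z → res (z ℤ.+ ℤ.1ℤ) ≡ sucMod (res z)
  res-suc z = trans (res-+ z 1) (cong (_% n) (ℕP.+-comm (res z) 1))

  res-idem : ∀ z → res (+ res z) ≡ res z
  res-idem z = m<n⇒m%n≡m (res<n z)

  sucMod-view : ∀ r → r < n → (suc r < n × sucMod r ≡ suc r) ⊎ (suc r ≡ n × sucMod r ≡ 0)
  sucMod-view r r<n with ℕP.m≤n⇒m<n∨m≡n r<n
  ... | inj₁ lt = inj₁ (lt , m<n⇒m%n≡m lt)
  ... | inj₂ eq = inj₂ (eq , trans (cong (_% n) eq) (n%n≡0 n))

  sucMod-injective : ∀ r r' → r < n → r' < n → sucMod r ≡ sucMod r' → r ≡ r'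
  sucMod-injective r r' r<n r'<n e with sucMod-view r r<n | sucMod-view r' r'<n
  ... | inj₁ (_ , a) | inj₁ (_ , b) = ℕP.suc-injective (trans (sym a) (trans e b))
  ... | inj₁ (_ , a) | inj₂ (_ , b) = contradiction (trans (sym a) (trans e b)) ℕP.1+n≢0
  ... | inj₂ (_ , a) | inj₁ (_ , b) = contradiction (trans (sym b) (trans (sym e) a)) ℕP.1+n≢0
  ... | inj₂ (x , _) | inj₂ (y , _) = ℕP.suc-injective (trans x (sym y))

  res-pred : ∀ z α → α < n → res z ≡ sucMod α → res (z ℤ.- ℤ.1ℤ) ≡ α
  res-pred z α α<n e = sucMod-injective _ _ (res<n (z ℤ.- ℤ.1ℤ)) α<n
    (trans (sym (res-suc (z ℤ.- ℤ.1ℤ))) (trans (cong res (pred-suc z)) e))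
    where
    pred-suc : ∀ z → z ℤ.- ℤ.1ℤ ℤ.+ ℤ.1ℤ ≡ z
    pred-suc = solve-∀

  sucMod-≢ : 1 ≤ k → ∀ r → r < n → sucMod r ≢ r
  sucMod-≢ 1≤k r r<n e with sucMod-view r r<n
  ... | inj₁ (_ , a) = ℕP.1+n≢n (trans (sym a) e)
  ... | inj₂ (x , a) = ℕP.<⇒≱ (s≤s 1≤k) (ℕP.≤-reflexive (trans (sym x) (cong suc (trans (sym e) a))))

  sucMod²-≢ : 2 ≤ k → ∀ r → r < n → sucMod (sucMod r) ≢ r
  sucMod²-≢ 2≤k r r<n e with sucMod-view r r<n
  ... | inj₂ (x , a) with sucMod-view 0 (s≤s z≤n)
  ...   | inj₁ (_ , b) = ℕP.<⇒≱ (s≤s 2≤k) (ℕP.≤-reflexive (trans (sym x) (cong suc (trans (sym e) (trans (cong sucMod a) b)))))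
  ...   | inj₂ (y , _) = ℕP.<⇒≱ (s≤s 2≤k) (ℕP.≤-trans (ℕP.≤-reflexive (sym y)) (s≤s z≤n))
  sucMod²-≢ 2≤k r r<n e | inj₁ (x , a) with sucMod-view (suc r) x
  ...   | inj₁ (_ , b) = ℕP.<⇒≱ (ℕP.≤-trans (ℕP.n<1+n r) (ℕP.n≤1+n (suc r))) (ℕP.≤-reflexive (trans (sym b) (trans (cong sucMod (sym a)) e)))
  ...   | inj₂ (y , b) = ℕP.<⇒≱ (s≤s 2≤k) (ℕP.≤-reflexive (trans (sym y) (cong (λ v → suc (suc v)) (trans (sym e) (trans (cong sucMod a) b)))))

  [r+d]%n≢r : ∀ r d → r < n → 0 < d → d < n → (r ℕ.+ d) % n ≢ r
  [r+d]%n≢r r d r<n 0<d d<n eq with r ℕ.+ d ℕ.<? n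
  ... | yes lt = ℕP.<-irrefl (sym d≡0) 0<d
    where
    d≡0 : d ≡ 0
    d≡0 = ℕP.+-cancelˡ-≡ r d 0 (trans (trans (sym (m<n⇒m%n≡m lt)) eq) (sym (ℕP.+-identityʳ r)))
  ... | no r+d≮n = ℕP.<-irrefl d≡n d<n
    where
    n≤r+d : n ≤ r ℕ.+ d
    n≤r+d = ℕP.≮⇒≥ r+d≮n
    r+d∸n<n : r ℕ.+ d ∸ n < n
    r+d∸n<n = ℕP.<-≤-trans (ℕP.∸-monoˡ-< (ℕP.+-mono-< r<n d<n) n≤r+d) (ℕP.≤-reflexive (ℕP.m+n∸n≡m n n))
    d≡n : d ≡ n
    d≡n = ℕP.+-cancelˡ-≡ r d n (trans (sym (ℕP.m∸n+n≡m n≤r+d)) (cong (ℕ._+ n)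
            (trans (sym (m<n⇒m%n≡m r+d∸n<n)) (trans (m≤n⇒[n∸m]%m≡n%m n≤r+d) eq))))

  res-+-≢ : ∀ z d → 0 < d → d < n → res (z ℤ.+ + d) ≢ res z
  res-+-≢ z d 0<d d<n eq = [r+d]%n≢r (res z) d (res<n z) 0<d d<n (trans (sym (res-+ z d)) eq)

module Reflection (k : ℕ) where

  open Residue k

  s-raise : ∀ a m → res m ≡ res a → s k a m ≡ m ℤ.+ ℤ.1ℤ
  s-raise a m e with m ℤ.%ℕ suc k ℕ.≟ a ℤ.%ℕ suc k
  ... | yes _ = refl
  ... | no ne = contradiction e ne

  s-lower : ∀ a m → res m ≢ res a → res m ≡ sucMod (res a) → s k a m ≡ m ℤ.- ℤ.1ℤ
  s-lower a m ne e with m ℤ.%ℕ suc k ℕ.≟ a ℤ.%ℕ suc k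
  ... | yes e' = contradiction e' ne
  ... | no _ with m ℤ.%ℕ suc k ℕ.≟ (suc (a ℤ.%ℕ suc k)) % suc k
  ...   | yes _ = refl
  ...   | no ne' = contradiction e ne'

  s-fix : ∀ a m → res m ≢ res a → res m ≢ sucMod (res a) → s k a m ≡ m
  s-fix a m ne ne' with m ℤ.%ℕ suc k ℕ.≟ a ℤ.%ℕ suc k
  ... | yes e = contradiction e ne
  ... | no _ with m ℤ.%ℕ suc k ℕ.≟ (suc (a ℤ.%ℕ suc k)) % suc k
  ...   | yes e = contradiction e ne'
  ...   | no _ = refl

  data Position (a m : ℤ) : Set where
    at   : res m ≡ res a → Position a m
    next : res m ≢ res a → res m ≡ sucMod (res a) → Position a m
    away : res m ≢ res a → res m ≢ sucMod (res a) → Position a m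

  position : ∀ a m → Position a m
  position a m with res m ℕ.≟ res a | res m ℕ.≟ sucMod (res a)
  ... | yes e | _     = at e
  ... | no ne | yes e = next ne e
  ... | no ne | no ne' = away ne ne'

  s-cong-res : ∀ a b → res a ≡ res b → ∀ m → s k a m ≡ s k b m
  s-cong-res a b e m with position a m
  ... | at x = trans (s-raise a m x) (sym (s-raise b m (trans x e)))
  ... | next x y = trans (s-lower a m x y) (sym (s-lower b m (λ z → x (trans z (sym e))) (trans y (cong sucMod e))))
  ... | away x y = trans (s-fix a m x y) (sym (s-fix b m (λ z → x (trans z (sym e))) (λ z → y (trans z (cong sucMod (sym e))))))

  private
    suc-pred : ∀ m → m ℤ.+ ℤ.1ℤ ℤ.- ℤ.1ℤ ≡ m
    suc-pred = solve-∀
    pred-suc : ∀ m → m ℤ.- ℤ.1ℤ ℤ.+ ℤ.1ℤ ≡ m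
    pred-suc = solve-∀

  record Distant (a b : ℤ) : Set where
    field
      res-b≢res-a  : res b ≢ res a
      res-b≢next-a : res b ≢ sucMod (res a)
      res-a≢next-b : res a ≢ sucMod (res b)

  Distant-sym : ∀ {a b} → Distant a b → Distant b a
  Distant-sym h = record
    { res-b≢res-a = λ e → res-b≢res-a (sym e) ; res-b≢next-a = res-a≢next-b ; res-a≢next-b = res-b≢next-a }
    where open Distant h

  private
    s-comm-at : ∀ a b m → Distant a b → res m ≡ res a → s k a (s k b m) ≡ s k b (s k a m)
    s-comm-at a b m h e =
      trans (cong (s k a) s-b-m) (trans (s-raise a m e) (sym (trans (cong (s k b) (s-raise a m e)) (s-fix b _ ≢b ≢next-b))))
      where
      open Distant h
      s-b-m : s k b m ≡ m
      s-b-m = s-fix b m (λ e' → res-b≢res-a (trans (sym e') e)) (λ e' → res-a≢next-b (trans (sym e) e'))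
      res-m+1 : res (m ℤ.+ ℤ.1ℤ) ≡ sucMod (res a)
      res-m+1 = trans (res-suc m) (cong sucMod e)
      ≢b : res (m ℤ.+ ℤ.1ℤ) ≢ res b
      ≢b e' = res-b≢next-a (trans (sym e') res-m+1)
      ≢next-b : res (m ℤ.+ ℤ.1ℤ) ≢ sucMod (res b)
      ≢next-b e' = res-b≢res-a (sym (sucMod-injective _ _ (res<n a) (res<n b) (trans (sym res-m+1) e')))

    s-comm-at-next : ∀ a b m → Distant a b → res m ≢ res a → res m ≡ sucMod (res a) →
                     s k a (s k b m) ≡ s k b (s k a m)
    s-comm-at-next a b m h ne e =
      trans (cong (s k a) s-b-m) (trans (s-lower a m ne e) (sym (trans (cong (s k b) (s-lower a m ne e)) (s-fix b _ ≢b ≢next-b))))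
      where
      open Distant h
      s-b-m : s k b m ≡ m
      s-b-m = s-fix b m (λ e' → res-b≢next-a (trans (sym e') e))
                        (λ e' → res-b≢res-a (sucMod-injective _ _ (res<n b) (res<n a) (trans (sym e') e)))
      res-m-1 : res (m ℤ.- ℤ.1ℤ) ≡ res a
      res-m-1 = res-pred m (res a) (res<n a) e
      ≢b : res (m ℤ.- ℤ.1ℤ) ≢ res b
      ≢b e' = res-b≢res-a (trans (sym e') res-m-1)
      ≢next-b : res (m ℤ.- ℤ.1ℤ) ≢ sucMod (res b)
      ≢next-b e' = res-a≢next-b (trans (sym res-m-1) e')

  s-comm : ∀ a b → Distant a b → ∀ m → s k a (s k b m) ≡ s k b (s k a m)
  s-comm a b h m with position a m | position b m
  ... | at e      | _         = s-comm-at a b m h e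
  ... | next ne e | _         = s-comm-at-next a b m h ne e
  ... | away _ _  | at e      = sym (s-comm-at b a m (Distant-sym h) e)
  ... | away _ _  | next ne e = sym (s-comm-at-next b a m (Distant-sym h) ne e)
  ... | away n₁ n₂ | away n₃ n₄ =
    trans (cong (s k a) (s-fix b m n₃ n₄))
      (trans (s-fix a m n₁ n₂) (sym (trans (cong (s k b) (s-fix a m n₁ n₂)) (s-fix b m n₃ n₄))))

  Distant-+ : ∀ x d → 2 ≤ d → d ℕ.+ 2 ≤ n → Distant (x ℤ.+ + d) x
  Distant-+ x d 2≤d d+2≤n = record
    { res-b≢res-a  = λ e → res-+-≢ x d 0<d d<n (sym e)
    ; res-b≢next-a = λ e → res-+-≢ x (suc d) (s≤s z≤n) d+1<n
                             (trans (sym (cong res (+-assoc-1 x (+ d)))) (trans (res-suc (x ℤ.+ + d)) (sym e)))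
    ; res-a≢next-b = λ e → res-+-≢ (x ℤ.+ ℤ.1ℤ) (ℕ.pred d) (ℕP.pred-mono-≤ 2≤d) (ℕP.≤-<-trans ℕP.pred[n]≤n d<n)
                             (trans (cong res x+1+[d-1]≡x+d) (trans e (sym (res-suc x)))) }
    where
    d<n : d < n
    d<n = ℕP.≤-trans (ℕP.n≤1+n (suc d)) (ℕP.≤-trans (ℕP.≤-reflexive (ℕP.+-comm 2 d)) d+2≤n)
    d+1<n : suc d < n
    d+1<n = ℕP.≤-trans (ℕP.≤-reflexive (ℕP.+-comm 2 d)) d+2≤n
    0<d : 0 < d
    0<d = ℕP.<-≤-trans (s≤s z≤n) 2≤d
    +-assoc-1 : ∀ x y → x ℤ.+ y ℤ.+ ℤ.1ℤ ≡ x ℤ.+ (ℤ.1ℤ ℤ.+ y)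
    +-assoc-1 = solve-∀
    x+1+[d-1]≡x+d : x ℤ.+ ℤ.1ℤ ℤ.+ + ℕ.pred d ≡ x ℤ.+ + d
    x+1+[d-1]≡x+d = trans (ℤP.+-assoc x ℤ.1ℤ (+ ℕ.pred d))
                      (cong (λ v → x ℤ.+ + v) (ℕP.suc-pred d {{ℕ.>-nonZero 0<d}}))

  module _ (2≤k : 2 ≤ k) (a b : ℤ) (hb : res b ≡ sucMod (res a)) where

    private
      1≤k : 1 ≤ k
      1≤k = ℕP.≤-trans (s≤s z≤n) 2≤k
      res-b≢res-a : res b ≢ res a
      res-b≢res-a e = sucMod-≢ 1≤k (res a) (res<n a) (trans (sym hb) e)
      next-b≢res-a : sucMod (res b) ≢ res a
      next-b≢res-a e = sucMod²-≢ 2≤k (res a) (res<n a) (trans (cong sucMod (sym hb)) e)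
      next-b≢res-b : sucMod (res b) ≢ res b
      next-b≢res-b = sucMod-≢ 1≤k (res b) (res<n b)

      braid-at-a : ∀ m → res m ≡ res a → s k a (s k b (s k a m)) ≡ s k b (s k a (s k b m))
      braid-at-a m e = begin
        s k a (s k b (s k a m))
          ≡⟨ cong (λ v → s k a (s k b v)) (s-raise a m e) ⟩
        s k a (s k b m₁)
          ≡⟨ cong (s k a) (s-raise b m₁ r₁) ⟩
        s k a (m₁ ℤ.+ ℤ.1ℤ)
          ≡⟨ s-fix a (m₁ ℤ.+ ℤ.1ℤ) (λ e' → next-b≢res-a (trans (sym r₂) e')) (λ e' → next-b≢res-b (trans (sym r₂) (trans e' (sym hb)))) ⟩
        m₁ ℤ.+ ℤ.1ℤ
          ≡⟨ s-raise b m₁ r₁ ⟨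
        s k b m₁
          ≡⟨ cong (s k b) (s-raise a m e) ⟨
        s k b (s k a m)
          ≡⟨ cong (λ v → s k b (s k a v)) (s-fix b m (λ e' → res-b≢res-a (trans (sym e') e)) (λ e' → next-b≢res-a (trans (sym e') e))) ⟨
        s k b (s k a (s k b m)) ∎
        where
        open ≡-Reasoning
        m₁ : ℤ
        m₁ = m ℤ.+ ℤ.1ℤ
        r₁ : res m₁ ≡ res b
        r₁ = trans (res-suc m) (trans (cong sucMod e) (sym hb))
        r₂ : res (m₁ ℤ.+ ℤ.1ℤ) ≡ sucMod (res b)
        r₂ = trans (res-suc m₁) (cong sucMod r₁)

      braid-at-b : ∀ m → res m ≢ res a → res m ≡ res b → s k a (s k b (s k a m)) ≡ s k b (s k a (s k b m))
      braid-at-b m ne e = begin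
        s k a (s k b (s k a m))
          ≡⟨ cong (λ v → s k a (s k b v)) (s-lower a m ne (trans e hb)) ⟩
        s k a (s k b m₁)
          ≡⟨ cong (s k a) (s-fix b m₁ (λ e' → res-b≢res-a (trans (sym e') r₁)) (λ e' → next-b≢res-a (trans (sym e') r₁))) ⟩
        s k a m₁
          ≡⟨ s-raise a m₁ r₁ ⟩
        m₁ ℤ.+ ℤ.1ℤ
          ≡⟨ trans (pred-suc m) (sym (suc-pred m)) ⟩
        m₂ ℤ.- ℤ.1ℤ
          ≡⟨ s-lower b m₂ (λ e' → next-b≢res-b (trans (sym r₂) e')) r₂ ⟨
        s k b m₂
          ≡⟨ cong (s k b) (s-fix a m₂ (λ e' → next-b≢res-a (trans (sym r₂) e')) (λ e' → next-b≢res-b (trans (sym r₂) (trans e' (sym hb))))) ⟨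
        s k b (s k a m₂)
          ≡⟨ cong (λ v → s k b (s k a v)) (s-raise b m e) ⟨
        s k b (s k a (s k b m)) ∎
        where
        open ≡-Reasoning
        m₁ m₂ : ℤ
        m₁ = m ℤ.- ℤ.1ℤ
        m₂ = m ℤ.+ ℤ.1ℤ
        r₁ : res m₁ ≡ res a
        r₁ = res-pred m (res a) (res<n a) (trans e hb)
        r₂ : res m₂ ≡ sucMod (res b)
        r₂ = trans (res-suc m) (cong sucMod e)

      braid-after-b : ∀ m → s k a m ≡ m → res m ≢ res b → res m ≡ sucMod (res b) →
                      s k a (s k b (s k a m)) ≡ s k b (s k a (s k b m))
      braid-after-b m fix-a nb e = begin
        s k a (s k b (s k a m))
          ≡⟨ cong (λ v → s k a (s k b v)) fix-a ⟩
        s k a (s k b m)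
          ≡⟨ cong (s k a) (s-lower b m nb e) ⟩
        s k a m₁
          ≡⟨ s-lower a m₁ (λ e' → res-b≢res-a (trans (sym r₁) e')) (trans r₁ hb) ⟩
        m₁ ℤ.- ℤ.1ℤ
          ≡⟨ s-fix b (m₁ ℤ.- ℤ.1ℤ) (λ e' → res-b≢res-a (trans (sym e') r₂)) (λ e' → next-b≢res-a (trans (sym e') r₂)) ⟨
        s k b (m₁ ℤ.- ℤ.1ℤ)
          ≡⟨ cong (s k b) (s-lower a m₁ (λ e' → res-b≢res-a (trans (sym r₁) e')) (trans r₁ hb)) ⟨
        s k b (s k a m₁)
          ≡⟨ cong (λ v → s k b (s k a v)) (s-lower b m nb e) ⟨
        s k b (s k a (s k b m)) ∎
        where
        open ≡-Reasoning
        m₁ : ℤ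
        m₁ = m ℤ.- ℤ.1ℤ
        r₁ : res m₁ ≡ res b
        r₁ = res-pred m (res b) (res<n b) e
        r₂ : res (m₁ ℤ.- ℤ.1ℤ) ≡ res a
        r₂ = res-pred m₁ (res a) (res<n a) (trans r₁ hb)

    s-braid : ∀ m → s k a (s k b (s k a m)) ≡ s k b (s k a (s k b m))
    s-braid m with position a m | position b m
    ... | at e        | _           = braid-at-a m e
    ... | next ne e   | _           = braid-at-b m ne (trans e (sym hb))
    ... | away _ ne′  | at e        = contradiction (trans e hb) ne′
    ... | away ne ne′ | next nb e   = braid-after-b m (s-fix a m ne ne′) nb e
    ... | away ne ne′ | away nb nb′ = begin
      s k a (s k b (s k a m)) ≡⟨ cong (λ v → s k a (s k b v)) fix-a ⟩
      s k a (s k b m)         ≡⟨ cong (s k a) fix-b ⟩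
      s k a m                 ≡⟨ trans fix-a (sym fix-b) ⟩
      s k b m                 ≡⟨ cong (s k b) fix-a ⟨
      s k b (s k a m)         ≡⟨ cong (λ v → s k b (s k a v)) fix-b ⟨
      s k b (s k a (s k b m)) ∎
      where
      open ≡-Reasoning
      fix-a : s k a m ≡ m
      fix-a = s-fix a m ne ne′
      fix-b : s k b m ≡ m
      fix-b = s-fix b m nb nb′

rows : (ℕ → List ℤ) → ℕ → ℕ → List ℤ
rows f y zero    = []
rows f y (suc x) = f (suc (x ℕ.+ y)) ++ rows f y x

topRows : (ℕ → List ℤ) → ℕ → List ℤ
topRows f zero    = []
topRows f (suc p) = f (suc p) ++ topRows f p

rows-peel : ∀ f y x → rows f y (suc x) ≡ rows f (suc y) x ++ f (suc y)
rows-peel f y zero    = ++-identityʳ (f (suc y))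
rows-peel f y (suc x) = begin
  f (suc (suc x ℕ.+ y)) ++ rows f y (suc x)                  ≡⟨ cong (f (suc (suc x ℕ.+ y)) ++_) (rows-peel f y x) ⟩
  f (suc (suc x ℕ.+ y)) ++ (rows f (suc y) x ++ f (suc y))   ≡⟨ ++-assoc (f (suc (suc x ℕ.+ y))) _ _ ⟨
  (f (suc (suc x ℕ.+ y)) ++ rows f (suc y) x) ++ f (suc y)   ≡⟨ cong (λ v → (f (suc v) ++ rows f (suc y) x) ++ f (suc y)) (sym (ℕP.+-suc x y)) ⟩
  rows f (suc y) (suc x) ++ f (suc y)                         ∎
  where open ≡-Reasoning

module Words (k : ℕ) where

  open Residue k
  open Reflection k

  act-++ : ∀ w v m → act k (w ++ v) m ≡ act k w (act k v m)
  act-++ []      v m = refl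
  act-++ (a ∷ w) v m = cong (s k a) (act-++ w v m)

  infix 4 _≈_
  record _≈_ (w v : List ℤ) : Set where
    constructor mk≈
    field act-≡ : ∀ m → act k w m ≡ act k v m
  open _≈_ public

  ++-cong : ∀ {w w' v v'} → w ≈ w' → v ≈ v' → (w ++ v) ≈ (w' ++ v')
  ++-cong {w} {w'} {v} {v'} p q = mk≈ λ m → begin
    act k (w ++ v) m      ≡⟨ act-++ w v m ⟩
    act k w (act k v m)   ≡⟨ act-≡ p (act k v m) ⟩
    act k w' (act k v m)  ≡⟨ cong (act k w') (act-≡ q m) ⟩
    act k w' (act k v' m) ≡⟨ act-++ w' v' m ⟨
    act k (w' ++ v') m    ∎
    where open ≡-Reasoning

  word-monoid : Monoid _ _
  word-monoid = record
    { Carrier  = List ℤ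
    ; _≈_      = _≈_
    ; _∙_      = _++_
    ; ε        = []
    ; isMonoid = record
      { isSemigroup = record
        { isMagma = record
          { isEquivalence = record
            { refl  = mk≈ λ _ → refl
            ; sym   = λ p → mk≈ λ m → sym (act-≡ p m)
            ; trans = λ p q → mk≈ λ m → trans (act-≡ p m) (act-≡ q m) }
          ; ∙-cong = ++-cong }
        ; assoc = λ w v u → mk≈ λ m → cong (λ x → act k x m) (++-assoc w v u) }
      ; identity = (λ w → mk≈ λ _ → refl) , (λ w → mk≈ λ m → cong (λ x → act k x m) (++-identityʳ w)) } }

  open Monoid word-monoid public using () renaming (refl to ≈-refl; sym to ≈-sym; trans to ≈-trans; reflexive to ≡⇒≈)
  module ≈-Reasoning = Relation.Binary.Reasoning.Setoid (Monoid.setoid word-monoid)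
  module ++-Solver = Algebra.Solver.Monoid word-monoid

  ++-congˡ : ∀ w {v v'} → v ≈ v' → (w ++ v) ≈ (w ++ v')
  ++-congˡ w = ++-cong (≈-refl {w})

  ++-congʳ : ∀ {w w'} v → w ≈ w' → (w ++ v) ≈ (w' ++ v)
  ++-congʳ v p = ++-cong p (≈-refl {v})

  ∷-congˡ : ∀ a {v v'} → v ≈ v' → (a ∷ v) ≈ (a ∷ v')
  ∷-congˡ a = ++-congˡ [ a ]

  ∷-cong : ∀ {a b v v'} → res a ≡ res b → v ≈ v' → (a ∷ v) ≈ (b ∷ v')
  ∷-cong {a} {b} {v} e p = mk≈ λ m → trans (s-cong-res a b e (act k v m)) (cong (s k b) (act-≡ p m))

  -- 2 ≤ |u − x| ≤ n − 2: at distance n − 1 the letters are adjacent modulo n.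
  Far : ℤ → ℤ → Set
  Far u x = Σ ℕ λ d → (u ≡ x ℤ.+ + d ⊎ x ≡ u ℤ.+ + d) × 2 ≤ d × d ℕ.+ 2 ≤ n

  Far-comm : ∀ {u x} → Far u x → (u ∷ x ∷ []) ≈ (x ∷ u ∷ [])
  Far-comm {x = x} (d , inj₁ refl , p , q) = mk≈ (s-comm (x ℤ.+ + d) x (Distant-+ x d p q))
  Far-comm {u = u} (d , inj₂ refl , p , q) = mk≈ λ m → sym (s-comm (u ℤ.+ + d) u (Distant-+ u d p q) m)

  ∷-comm : ∀ {u w} → All (Far u) w → (u ∷ w) ≈ (w ++ [ u ])
  ∷-comm {w = []}    []       = ≈-refl
  ∷-comm {w = x ∷ w} (f ∷ fs) = ≈-trans (++-congʳ w (Far-comm f)) (∷-congˡ x (∷-comm fs))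

  ++-comm : ∀ {w v} → All (λ u → All (Far u) v) w → (w ++ v) ≈ (v ++ w)
  ++-comm {[]}    {v} []       = ≡⇒≈ (sym (++-identityʳ v))
  ++-comm {u ∷ w} {v} (f ∷ fs) = begin
    u ∷ (w ++ v)      ≈⟨ ∷-congˡ u (++-comm fs) ⟩
    (u ∷ v) ++ w      ≈⟨ ++-congʳ w (∷-comm f) ⟩
    (v ++ [ u ]) ++ w ≡⟨ ++-assoc v [ u ] w ⟩
    v ++ (u ∷ w)      ∎
    where open ≈-Reasoning

  ∷-pull : ∀ {u} w v → All (Far u) w → (w ++ (u ∷ v)) ≈ (u ∷ (w ++ v))
  ∷-pull {u} w v f = begin
    w ++ (u ∷ v)      ≡⟨ ++-assoc w [ u ] v ⟨
    (w ++ [ u ]) ++ v ≈⟨ ++-congʳ v (∷-comm f) ⟨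
    (u ∷ w) ++ v      ∎
    where open ≈-Reasoning

  braid : 2 ≤ k → ∀ a → (a ℤ.+ ℤ.1ℤ ∷ a ∷ a ℤ.+ ℤ.1ℤ ∷ []) ≈ (a ∷ a ℤ.+ ℤ.1ℤ ∷ a ∷ [])
  braid 2≤k a = mk≈ λ m → sym (s-braid 2≤k a (a ℤ.+ ℤ.1ℤ) (res-suc a) m)

  stepDown-++ : ∀ t₁ t₂ b → stepDown b (t₁ ℕ.+ t₂) ≡ stepDown b t₁ ++ stepDown (b ℤ.- + t₁) t₂
  stepDown-++ zero     t₂ b = cong (λ v → stepDown v t₂) (sym (ℤP.+-identityʳ b))
  stepDown-++ (suc t₁) t₂ b = cong (b ∷_) (trans (stepDown-++ t₁ t₂ (b ℤ.- ℤ.1ℤ))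
    (cong (λ v → stepDown (b ℤ.- ℤ.1ℤ) t₁ ++ stepDown v t₂) (sub-suc b (+ t₁))))
    where
    sub-suc : ∀ b x → b ℤ.- ℤ.1ℤ ℤ.- x ≡ b ℤ.- (ℤ.1ℤ ℤ.+ x)
    sub-suc = solve-∀

  stepUp-∷ʳ : ∀ d A → stepUp A (suc d) ≡ stepUp A d ++ [ A ℤ.+ + d ]
  stepUp-∷ʳ zero    A = cong [_] (sym (ℤP.+-identityʳ A))
  stepUp-∷ʳ (suc d) A = cong (A ∷_) (trans (stepUp-∷ʳ d (A ℤ.+ ℤ.1ℤ))
    (cong (λ v → stepUp (A ℤ.+ ℤ.1ℤ) d ++ [ v ]) (ℤP.+-assoc A ℤ.1ℤ (+ d))))

  All-Far-above : ∀ t b u d → u ≡ b ℤ.+ + d → 2 ≤ d → d ℕ.+ t < n → All (Far u) (stepDown b t)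
  All-Far-above zero    b u d _ _ _ = []
  All-Far-above (suc t) b u d u≡ 2≤d d+t<n =
    (d , inj₁ u≡ , 2≤d , ℕP.≤-trans (ℕP.≤-reflexive (ℕP.+-suc d 1)) (ℕP.≤-trans (s≤s (ℕP.+-monoʳ-≤ d (s≤s z≤n))) d+t<n))
    ∷ All-Far-above t (b ℤ.- ℤ.1ℤ) u (suc d) (trans u≡ (shift b (+ d))) (ℕP.m≤n⇒m≤1+n 2≤d)
        (ℕP.≤-trans (ℕP.≤-reflexive (cong suc (sym (ℕP.+-suc d t)))) d+t<n)
    where
    shift : ∀ b x → b ℤ.+ x ≡ (b ℤ.- ℤ.1ℤ) ℤ.+ (ℤ.1ℤ ℤ.+ x)
    shift = solve-∀

  All-Far-below : ∀ t b u d → b ℤ.+ ℤ.1ℤ ≡ u ℤ.+ + (d ℕ.+ t) → 2 ≤ d → d ℕ.+ t < n → All (Far u) (stepDown b t)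
  All-Far-below zero    b u d _ _ _ = []
  All-Far-below (suc t) b u d b+1≡ 2≤d d+t<n =
    (d ℕ.+ t , inj₂ b≡ , ℕP.≤-trans 2≤d (ℕP.m≤m+n d t) ,
      ℕP.≤-trans (ℕP.≤-reflexive (ℕP.+-comm (d ℕ.+ t) 2)) (ℕP.≤-trans (ℕP.≤-reflexive (cong suc (sym (ℕP.+-suc d t)))) d+t<n))
    ∷ All-Far-below t (b ℤ.- ℤ.1ℤ) u d (trans (pred-suc b) b≡) 2≤d (ℕP.≤-trans (s≤s (ℕP.+-monoʳ-≤ d (ℕP.n≤1+n t))) d+t<n)
    where
    pred-suc : ∀ b → b ℤ.- ℤ.1ℤ ℤ.+ ℤ.1ℤ ≡ b
    pred-suc = solve-∀
    cancel-suc : ∀ b u x → b ℤ.+ ℤ.1ℤ ≡ u ℤ.+ (ℤ.1ℤ ℤ.+ x) → b ≡ u ℤ.+ x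
    cancel-suc b u x e = trans (sym (suc-pred b)) (trans (cong (ℤ._- ℤ.1ℤ) e) (drop u x))
      where
      suc-pred : ∀ b → b ℤ.+ ℤ.1ℤ ℤ.- ℤ.1ℤ ≡ b
      suc-pred = solve-∀
      drop : ∀ u x → u ℤ.+ (ℤ.1ℤ ℤ.+ x) ℤ.- ℤ.1ℤ ≡ u ℤ.+ x
      drop = solve-∀
    b≡ : b ≡ u ℤ.+ + (d ℕ.+ t)
    b≡ = cancel-suc b u (+ (d ℕ.+ t)) (trans b+1≡ (cong (λ v → u ℤ.+ + v) (ℕP.+-suc d t)))

  stepDown-stepDown-comm : ∀ T t b B g → B ≡ b ℤ.+ + g → T < g → g ℕ.+ t < n →
                           (stepDown B T ++ stepDown b t) ≈ (stepDown b t ++ stepDown B T)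
  stepDown-stepDown-comm T t b B g B≡ T<g g+t<n = ++-comm (all-far T B g B≡ T<g g+t<n)
    where
    all-far : ∀ T B g → B ≡ b ℤ.+ + g → T < g → g ℕ.+ t < n → All (λ u → All (Far u) (stepDown b t)) (stepDown B T)
    all-far zero    B g       _  _         _ = []
    all-far (suc T) B (suc g) B≡ (s≤s T<g) q =
      All-Far-above t b B (suc g) B≡ (s≤s (ℕP.≤-trans (s≤s z≤n) T<g)) q
      ∷ all-far T (B ℤ.- ℤ.1ℤ) g (trans (cong (ℤ._- ℤ.1ℤ) B≡) (drop b (+ g))) T<g (ℕP.<-trans (ℕP.n<1+n _) q)
      where
      drop : ∀ b x → b ℤ.+ (ℤ.1ℤ ℤ.+ x) ℤ.- ℤ.1ℤ ≡ b ℤ.+ x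
      drop = solve-∀

  stepUp-stepDown-comm : ∀ T t b A g → b ℤ.+ ℤ.1ℤ ≡ A ℤ.+ + (g ℕ.+ t) → T < g → g ℕ.+ t < n →
                         (stepUp A T ++ stepDown b t) ≈ (stepDown b t ++ stepUp A T)
  stepUp-stepDown-comm T t b A g b+1≡ T<g g+t<n = ++-comm (all-far T A g b+1≡ T<g g+t<n)
    where
    all-far : ∀ T A g → b ℤ.+ ℤ.1ℤ ≡ A ℤ.+ + (g ℕ.+ t) → T < g → g ℕ.+ t < n →
              All (λ u → All (Far u) (stepDown b t)) (stepUp A T)
    all-far zero    A g       _   _         _ = []
    all-far (suc T) A (suc g) b+1≡ (s≤s T<g) q =
      All-Far-below t b A (suc g) b+1≡ (s≤s (ℕP.≤-trans (s≤s z≤n) T<g)) q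
      ∷ all-far T (A ℤ.+ ℤ.1ℤ) g (trans b+1≡ (sym (ℤP.+-assoc A ℤ.1ℤ (+ (g ℕ.+ t))))) T<g (ℕP.<-trans (ℕP.n<1+n _) q)

  letter-through-stepDown : ∀ t b e B → B ≡ b ℤ.- + e → 2 ℕ.+ e ≤ t → t < n →
                            (stepDown b t ++ [ B ]) ≈ ((B ℤ.- ℤ.1ℤ) ∷ stepDown b t)
  letter-through-stepDown (suc zero) _ zero _ _ (s≤s ()) _
  letter-through-stepDown (suc (suc t)) b zero B B≡ _ q = begin
    b ∷ b₁ ∷ (stepDown b₂ t ++ [ B ])
      ≈⟨ ∷-congˡ b (∷-congˡ b₁ (∷-comm far)) ⟨
    b ∷ b₁ ∷ B ∷ stepDown b₂ t
      ≡⟨ cong₂ (λ x y → x ∷ b₁ ∷ y ∷ stepDown b₂ t) (sym (pred-suc b)) (trans B≡b (sym (pred-suc b))) ⟩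
    (b₁ ℤ.+ ℤ.1ℤ ∷ b₁ ∷ b₁ ℤ.+ ℤ.1ℤ ∷ []) ++ stepDown b₂ t
      ≈⟨ ++-congʳ (stepDown b₂ t) (braid 2≤k b₁) ⟩
    (b₁ ∷ b₁ ℤ.+ ℤ.1ℤ ∷ b₁ ∷ []) ++ stepDown b₂ t
      ≡⟨ cong₂ (λ x y → x ∷ y ∷ b₁ ∷ stepDown b₂ t) (cong (ℤ._- ℤ.1ℤ) (sym B≡b)) (pred-suc b) ⟩
    (B ℤ.- ℤ.1ℤ) ∷ b ∷ b₁ ∷ stepDown b₂ t              ∎
    where
    open ≈-Reasoning
    b₁ b₂ : ℤ
    b₁ = b ℤ.- ℤ.1ℤ
    b₂ = b₁ ℤ.- ℤ.1ℤ
    pred-suc : ∀ b → b ℤ.- ℤ.1ℤ ℤ.+ ℤ.1ℤ ≡ b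
    pred-suc = solve-∀
    B≡b : B ≡ b
    B≡b = trans B≡ (ℤP.+-identityʳ b)
    2≤k : 2 ≤ k
    2≤k = ℕP.≤-pred (ℕP.≤-trans (s≤s (s≤s (s≤s z≤n))) q)
    b≡b₂+2 : ∀ b → b ≡ b ℤ.- ℤ.1ℤ ℤ.- ℤ.1ℤ ℤ.+ + 2
    b≡b₂+2 = solve-∀
    far : All (Far B) (stepDown b₂ t)
    far = All-Far-above t b₂ B 2 (trans B≡b (b≡b₂+2 b)) ℕP.≤-refl q
  letter-through-stepDown (suc t) b (suc e) B B≡ p q = begin
    b ∷ (stepDown b₁ t ++ [ B ])
      ≈⟨ ∷-congˡ b (letter-through-stepDown t b₁ e B (trans B≡ (sym (sub-suc b (+ e)))) (ℕP.≤-pred p) (ℕP.<-trans (ℕP.n<1+n t) q)) ⟩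
    b ∷ (B ℤ.- ℤ.1ℤ) ∷ stepDown b₁ t
      ≈⟨ ++-congʳ (stepDown b₁ t) (Far-comm far) ⟩
    (B ℤ.- ℤ.1ℤ) ∷ b ∷ stepDown b₁ t ∎
    where
    open ≈-Reasoning
    b₁ : ℤ
    b₁ = b ℤ.- ℤ.1ℤ
    sub-suc : ∀ b x → b ℤ.- ℤ.1ℤ ℤ.- x ≡ b ℤ.- (ℤ.1ℤ ℤ.+ x)
    sub-suc = solve-∀
    b≡ : ∀ b x → b ≡ b ℤ.- (ℤ.1ℤ ℤ.+ x) ℤ.- ℤ.1ℤ ℤ.+ (ℤ.1ℤ ℤ.+ (ℤ.1ℤ ℤ.+ x))
    b≡ = solve-∀
    far : Far b (B ℤ.- ℤ.1ℤ)
    far = 2 ℕ.+ e , inj₁ (trans (b≡ b (+ e)) (cong (λ v → v ℤ.- ℤ.1ℤ ℤ.+ + (2 ℕ.+ e)) (sym B≡))) , s≤s (s≤s z≤n) ,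
          ℕP.≤-trans (ℕP.≤-reflexive (cong (λ v → suc (suc v)) (ℕP.+-comm e 2))) (ℕP.≤-trans (s≤s p) q)

  stepDown-through-stepDown : ∀ T t b e B → B ≡ b ℤ.- + e → e ℕ.+ T < t → t < n →
                              (stepDown b t ++ stepDown B T) ≈ (stepDown (B ℤ.- ℤ.1ℤ) T ++ stepDown b t)
  stepDown-through-stepDown zero    t b e B _  _ _ = ≡⇒≈ (++-identityʳ (stepDown b t))
  stepDown-through-stepDown (suc T) t b e B B≡ p q = begin
    stepDown b t ++ (B ∷ stepDown B₁ T)
      ≡⟨ ++-assoc (stepDown b t) [ B ] (stepDown B₁ T) ⟨
    (stepDown b t ++ [ B ]) ++ stepDown B₁ T
      ≈⟨ ++-congʳ (stepDown B₁ T) (letter-through-stepDown t b e B B≡ 2+e≤t q) ⟩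
    B₁ ∷ (stepDown b t ++ stepDown B₁ T)
      ≈⟨ ∷-congˡ B₁ (stepDown-through-stepDown T t b (suc e) B₁ B₁≡ (ℕP.≤-trans (ℕP.≤-reflexive (cong suc (sym (ℕP.+-suc e T)))) p) q) ⟩
    B₁ ∷ (stepDown (B₁ ℤ.- ℤ.1ℤ) T ++ stepDown b t) ∎
    where
    open ≈-Reasoning
    B₁ : ℤ
    B₁ = B ℤ.- ℤ.1ℤ
    sub-suc : ∀ b x → b ℤ.- x ℤ.- ℤ.1ℤ ≡ b ℤ.- (ℤ.1ℤ ℤ.+ x)
    sub-suc = solve-∀
    B₁≡ : B₁ ≡ b ℤ.- + suc e
    B₁≡ = trans (cong (ℤ._- ℤ.1ℤ) B≡) (sub-suc b (+ e))
    2+e≤t : 2 ℕ.+ e ≤ t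
    2+e≤t = ℕP.≤-trans (s≤s (s≤s (ℕP.m≤m+n e T))) (ℕP.≤-trans (ℕP.≤-reflexive (cong suc (sym (ℕP.+-suc e T)))) p)

  stepDown-stair : ∀ t b → suc t < n →
                   (stepDown (b ℤ.- ℤ.1ℤ) t ++ stepDown b t ++ [ b ℤ.- + t ]) ≈ (stepDown b (suc t) ++ stepDown b t)
  stepDown-stair zero    b _ = ≡⇒≈ (cong [_] (ℤP.+-identityʳ b))
  stepDown-stair (suc t) b q = begin
    b₁ ∷ (stepDown b₂ t ++ (b ∷ (stepDown b₁ t ++ [ b ℤ.- + suc t ])))
      ≈⟨ ∷-congˡ b₁ (∷-pull (stepDown b₂ t) _ far) ⟩
    b₁ ∷ b ∷ (stepDown b₂ t ++ (stepDown b₁ t ++ [ b ℤ.- + suc t ]))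
      ≡⟨ cong (λ v → b₁ ∷ b ∷ (stepDown b₂ t ++ (stepDown b₁ t ++ [ v ]))) (sym (sub-suc b (+ t))) ⟩
    b₁ ∷ b ∷ (stepDown (b₁ ℤ.- ℤ.1ℤ) t ++ (stepDown b₁ t ++ [ b₁ ℤ.- + t ]))
      ≈⟨ ∷-congˡ b₁ (∷-congˡ b (stepDown-stair t b₁ (ℕP.<-trans (ℕP.n<1+n _) q))) ⟩
    (b₁ ∷ b ∷ b₁ ∷ []) ++ (stepDown b₂ t ++ stepDown b₁ t)
      ≡⟨ cong (λ v → (b₁ ∷ v ∷ b₁ ∷ []) ++ (stepDown b₂ t ++ stepDown b₁ t)) (sym (pred-suc b)) ⟩
    (b₁ ∷ b₁ ℤ.+ ℤ.1ℤ ∷ b₁ ∷ []) ++ (stepDown b₂ t ++ stepDown b₁ t)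
      ≈⟨ ++-congʳ (stepDown b₂ t ++ stepDown b₁ t) (braid 2≤k b₁) ⟨
    (b₁ ℤ.+ ℤ.1ℤ ∷ b₁ ∷ b₁ ℤ.+ ℤ.1ℤ ∷ []) ++ (stepDown b₂ t ++ stepDown b₁ t)
      ≡⟨ cong (λ v → (v ∷ b₁ ∷ v ∷ []) ++ (stepDown b₂ t ++ stepDown b₁ t)) (pred-suc b) ⟩
    b ∷ b₁ ∷ b ∷ (stepDown b₂ t ++ stepDown b₁ t)
      ≈⟨ ∷-congˡ b (∷-congˡ b₁ (∷-pull (stepDown b₂ t) _ far)) ⟨
    b ∷ b₁ ∷ (stepDown b₂ t ++ (b ∷ stepDown b₁ t)) ∎
    where
    open ≈-Reasoning
    b₁ b₂ : ℤ
    b₁ = b ℤ.- ℤ.1ℤ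
    b₂ = b₁ ℤ.- ℤ.1ℤ
    pred-suc : ∀ b → b ℤ.- ℤ.1ℤ ℤ.+ ℤ.1ℤ ≡ b
    pred-suc = solve-∀
    sub-suc : ∀ b x → b ℤ.- ℤ.1ℤ ℤ.- x ≡ b ℤ.- (ℤ.1ℤ ℤ.+ x)
    sub-suc = solve-∀
    b≡b₂+2 : ∀ b → b ≡ b ℤ.- ℤ.1ℤ ℤ.- ℤ.1ℤ ℤ.+ + 2
    b≡b₂+2 = solve-∀
    2≤k : 2 ≤ k
    2≤k = ℕP.≤-pred (ℕP.≤-trans (s≤s (s≤s (s≤s z≤n))) q)
    far : All (Far b) (stepDown b₂ t)
    far = All-Far-above t b₂ b 2 (b≡b₂+2 b) ℕP.≤-refl q

  rows-cong : ∀ f g y x → (∀ p → y < p → p ≤ x ℕ.+ y → f p ≈ g p) → rows f y x ≈ rows g y x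
  rows-cong f g y zero    _  = ≈-refl
  rows-cong f g y (suc x) f≈g = ++-cong (f≈g (suc (x ℕ.+ y)) (s≤s (ℕP.m≤n+m y x)) ℕP.≤-refl)
                                        (rows-cong f g y x (λ p y<p p≤ → f≈g p y<p (ℕP.m≤n⇒m≤1+n p≤)))

  topRows-cong : ∀ f g y → (∀ p → 1 ≤ p → p ≤ y → f p ≈ g p) → topRows f y ≈ topRows g y
  topRows-cong f g zero    _   = ≈-refl
  topRows-cong f g (suc y) f≈g = ++-cong (f≈g (suc y) (s≤s z≤n) ℕP.≤-refl)
                                         (topRows-cong f g y (λ p 1≤p p≤ → f≈g p 1≤p (ℕP.m≤n⇒m≤1+n p≤)))

pos-∸ : ∀ {m n} → n ≤ m → + (m ∸ n) ≡ + m ℤ.- + n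
pos-∸ {m} {n} n≤m = sym (trans (ℤP.m-n≡m⊖n m n) (ℤP.⊖-≥ n≤m))

∸-+-∸ : ∀ {x y z} → z ≤ y → y ≤ x → (x ∸ y) ℕ.+ (y ∸ z) ≡ x ∸ z
∸-+-∸ {x} {y} {z} z≤y y≤x = trans (sym (ℕP.+-∸-assoc (x ∸ y) z≤y)) (cong (_∸ z) (ℕP.m∸n+n≡m y≤x))

-- Letters are kept as the integers q − p rather than their residues; s only sees them
-- modulo k + 1, and the integers make the shifts in the proof exact.
rowWord : (ℕ → ℕ) → ℕ → List ℤ
rowWord μ p = stepDown (+ μ p ℤ.- + p) (μ p)

rightWord : (ℕ → ℕ) → ℕ → ℕ → List ℤ
rightWord μ j p = stepDown (+ μ p ℤ.- + p) (μ p ∸ j)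

leftWord : ℕ → ℕ → List ℤ
leftWord j' p = stepDown (+ j' ℤ.- + p) j'

-- L is λ, a is λ'_j and j = j' + 1; right p and left p are the cells of row p right and
-- left of column j, slid p is row p of λ_x for i ≤ p ≤ a, and leg (a − i) = s_{1−a} ⋯ s_{−i}.
module Rows (k c : ℕ) (c≤k : c ≤ k) (L : ℕ → ℕ) (L≤c : ∀ p → L p ≤ c)
            (L-antitone : ∀ p q → 1 ≤ p → p ≤ q → L q ≤ L p)
            (j' a : ℕ) (a+c≤n : a ℕ.+ c ≤ suc k)
            (j≤L : ∀ p → 1 ≤ p → p ≤ a → suc j' ≤ L p) (L[1+a]≤j : L (suc a) ≤ suc j') where

  open Residue k
  open Words k

  j : ℕ
  j = suc j'

  R : ℕ → List ℤ
  R = rowWord L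

  right : ℕ → List ℤ
  right = rightWord L j

  left : ℕ → List ℤ
  left = leftWord j'

  slid : ℕ → List ℤ
  slid p = right (suc p) ++ left p

  leg : ℕ → List ℤ
  leg d = stepUp (ℤ.1ℤ ℤ.- + a) d

  L≡j+[L∸j] : ∀ p → j ≤ L p → L p ≡ j ℕ.+ (L p ∸ j)
  L≡j+[L∸j] p j≤ = sym (ℕP.m+[n∸m]≡n j≤)

  right-form : ∀ p → j ≤ L p → right p ≡ stepDown (+ (j ℕ.+ (L p ∸ j)) ℤ.- + p) (L p ∸ j)
  right-form p j≤ = cong (λ v → stepDown (+ v ℤ.- + p) (L p ∸ j)) (L≡j+[L∸j] p j≤)

  R-split : ∀ p → j ≤ L p → R p ≡ right p ++ ((+ j ℤ.- + p) ∷ left p)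
  R-split p j≤ = begin
    stepDown (+ L p ℤ.- + p) (L p)
      ≡⟨ cong (λ v → stepDown (+ v ℤ.- + p) v) L≡ ⟩
    stepDown b (j ℕ.+ E)
      ≡⟨ cong (stepDown b) (ℕP.+-comm j E) ⟩
    stepDown b (E ℕ.+ j)
      ≡⟨ stepDown-++ E j b ⟩
    stepDown b E ++ stepDown (b ℤ.- + E) j
      ≡⟨ cong₂ _++_ (sym (right-form p j≤)) (cong₂ (λ x y → x ∷ stepDown y j') (top (+ j') (+ E) (+ p)) (next (+ j') (+ E) (+ p))) ⟩
    right p ++ ((+ j ℤ.- + p) ∷ left p)       ∎
    where
    open ≡-Reasoning
    E : ℕ
    E = L p ∸ j
    L≡ : L p ≡ j ℕ.+ E
    L≡ = L≡j+[L∸j] p j≤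
    b : ℤ
    b = + (j ℕ.+ E) ℤ.- + p
    top : ∀ x y q → ℤ.1ℤ ℤ.+ x ℤ.+ y ℤ.- q ℤ.- y ≡ ℤ.1ℤ ℤ.+ x ℤ.- q
    top = solve-∀
    next : ∀ x y q → ℤ.1ℤ ℤ.+ x ℤ.+ y ℤ.- q ℤ.- y ℤ.- ℤ.1ℤ ≡ x ℤ.- q
    next = solve-∀

  right-left-comm : ∀ p → j ≤ L p → (right p ++ left p) ≈ (left p ++ right p)
  right-left-comm p j≤ rewrite right-form p j≤ =
    stepDown-stepDown-comm E j' (+ j' ℤ.- + p) (+ (j ℕ.+ E) ℤ.- + p) (suc E) (gap (+ j') (+ E) (+ p)) (ℕP.n<1+n E) bound
    where
    E : ℕ
    E = L p ∸ j
    bound : suc E ℕ.+ j' < n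
    bound = s≤s (ℕP.≤-trans (ℕP.≤-reflexive (cong suc (ℕP.+-comm E j')))
              (ℕP.≤-trans (ℕP.≤-reflexive (sym (L≡j+[L∸j] p j≤))) (ℕP.≤-trans (L≤c p) c≤k)))
    gap : ∀ x e q → ℤ.1ℤ ℤ.+ x ℤ.+ e ℤ.- q ≡ x ℤ.- q ℤ.+ (ℤ.1ℤ ℤ.+ e)
    gap = solve-∀

  right-empty : ∀ p → L p ≤ j → right p ≡ []
  right-empty p L≤j = cong (stepDown (+ L p ℤ.- + p)) (ℕP.m≤n⇒m∸n≡0 L≤j)

  -- The cell (p + 1, j) fills the hole: s_{j−p−1} · left (p + 1) · left p equals
  -- left (p + 1) · left p · s_{−p} (stepDown-stair), and s_{−p} commutes past right p.
  hole-down : ∀ p → 1 ≤ p → suc p ≤ a →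
              (R (suc p) ++ (right p ++ left p)) ≈ ((right (suc p) ++ left (suc p)) ++ (left p ++ (right p ++ [ ℤ.- + p ])))
  hole-down p 1≤p p<a = begin
    R (suc p) ++ (right p ++ left p)
      ≡⟨ cong (_++ (right p ++ left p)) (R-split (suc p) (j≤L (suc p) (s≤s z≤n) p<a)) ⟩
    (right (suc p) ++ (B ∷ left (suc p))) ++ (right p ++ left p)
      ≈⟨ ++-congˡ (right (suc p) ++ (B ∷ left (suc p))) (right-left-comm p j≤Lp) ⟩
    (right (suc p) ++ (B ∷ left (suc p))) ++ (left p ++ right p)
      ≡⟨ cong₂ (λ x y → (right (suc p) ++ (x ∷ y)) ++ (left p ++ right p)) B≡b left-suc ⟩
    (right (suc p) ++ stepDown b j) ++ (left p ++ right p)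
      ≈⟨ solve 4 (λ A B C D → (A ⊕ B) ⊕ (C ⊕ D) ⊜ A ⊕ ((B ⊕ C) ⊕ D)) ≈-refl (right (suc p)) (stepDown b j) (left p) (right p) ⟩
    right (suc p) ++ ((stepDown b j ++ left p) ++ right p)
      ≈⟨ ++-congˡ (right (suc p)) (++-congʳ (right p) (stepDown-stair j' b j<n)) ⟨
    right (suc p) ++ ((stepDown (b ℤ.- ℤ.1ℤ) j' ++ (left p ++ [ b ℤ.- + j' ])) ++ right p)
      ≡⟨ cong₂ (λ x y → right (suc p) ++ ((x ++ (left p ++ [ y ])) ++ right p)) (sym left-suc) b-j'≡ ⟩
    right (suc p) ++ ((left (suc p) ++ (left p ++ [ u ])) ++ right p)
      ≈⟨ solve 5 (λ A B C D E → A ⊕ ((B ⊕ C ⊕ D) ⊕ E) ⊜ (A ⊕ B) ⊕ C ⊕ D ⊕ E) ≈-refl (right (suc p)) (left (suc p)) (left p) [ u ] (right p) ⟩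
    (right (suc p) ++ left (suc p)) ++ (left p ++ (u ∷ right p))
      ≈⟨ ++-congˡ (right (suc p) ++ left (suc p)) (++-congˡ (left p) (∷-comm u-far)) ⟩
    (right (suc p) ++ left (suc p)) ++ (left p ++ (right p ++ [ u ])) ∎
    where
    open ≈-Reasoning
    open ++-Solver using (solve; _⊜_; _⊕_)
    b B u : ℤ
    b = + j' ℤ.- + p
    B = + j ℤ.- + suc p
    u = ℤ.- + p
    j≤Lp : j ≤ L p
    j≤Lp = j≤L p 1≤p (ℕP.<⇒≤ p<a)
    2+c≤n : 2 ℕ.+ c ≤ n
    2+c≤n = ℕP.≤-trans (ℕP.+-monoˡ-≤ c (ℕP.≤-trans (s≤s 1≤p) p<a)) a+c≤n
    j<n : suc j' < n
    j<n = ℕP.≤-trans (s≤s (ℕP.≤-trans j≤Lp (L≤c p))) (ℕP.≤-trans (ℕP.n≤1+n (suc c)) 2+c≤n)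
    B≡b : B ≡ b
    B≡b = cancel (+ j') (+ p)
      where
      cancel : ∀ x y → ℤ.1ℤ ℤ.+ x ℤ.- (ℤ.1ℤ ℤ.+ y) ≡ x ℤ.- y
      cancel = solve-∀
    left-suc : left (suc p) ≡ stepDown (b ℤ.- ℤ.1ℤ) j'
    left-suc = cong (λ v → stepDown v j') (shift (+ j') (+ p))
      where
      shift : ∀ x y → x ℤ.- (ℤ.1ℤ ℤ.+ y) ≡ x ℤ.- y ℤ.- ℤ.1ℤ
      shift = solve-∀
    b-j'≡ : b ℤ.- + j' ≡ u
    b-j'≡ = cancel (+ j') (+ p)
      where
      cancel : ∀ x y → x ℤ.- y ℤ.- x ≡ ℤ.- y
      cancel = solve-∀
    u-far : All (Far u) (right p)
    u-far = subst (All (Far u)) (sym (right-form p j≤Lp))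
      (All-Far-below E (+ (j ℕ.+ E) ℤ.- + p) u (suc j) (gap (+ j') (+ E) (+ p)) (s≤s (s≤s z≤n))
        (ℕP.≤-trans (ℕP.≤-reflexive (cong (λ v → suc (suc v)) (sym (L≡j+[L∸j] p j≤Lp)))) (ℕP.≤-trans (s≤s (s≤s (L≤c p))) 2+c≤n)))
      where
      E : ℕ
      E = L p ∸ j
      gap : ∀ x e q → ℤ.1ℤ ℤ.+ x ℤ.+ e ℤ.- q ℤ.+ ℤ.1ℤ ≡ ℤ.- q ℤ.+ ((ℤ.1ℤ ℤ.+ (ℤ.1ℤ ℤ.+ x)) ℤ.+ e)
      gap = solve-∀

  leg-comm : ∀ p d → 1 ≤ p → p ℕ.+ suc d ≡ a → (leg d ++ (left p ++ right p)) ≈ ((left p ++ right p) ++ leg d)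
  leg-comm p d 1≤p a≡ = begin
    leg d ++ (left p ++ right p)  ≈⟨ solve 3 (λ G V U → G ⊕ (V ⊕ U) ⊜ (G ⊕ V) ⊕ U) ≈-refl (leg d) (left p) (right p) ⟩
    (leg d ++ left p) ++ right p  ≈⟨ ++-congʳ (right p) leg-left-comm ⟩
    (left p ++ leg d) ++ right p  ≈⟨ solve 3 (λ V G U → (V ⊕ G) ⊕ U ⊜ V ⊕ (G ⊕ U)) ≈-refl (left p) (leg d) (right p) ⟩
    left p ++ (leg d ++ right p)  ≈⟨ ++-congˡ (left p) leg-right-comm ⟩
    left p ++ (right p ++ leg d)  ≈⟨ solve 3 (λ V U G → V ⊕ (U ⊕ G) ⊜ (V ⊕ U) ⊕ G) ≈-refl (left p) (right p) (leg d) ⟩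
    (left p ++ right p) ++ leg d  ∎
    where
    open ≈-Reasoning
    open ++-Solver using (solve; _⊜_; _⊕_)
    A : ℤ
    A = ℤ.1ℤ ℤ.- + a
    A≡ : A ≡ ℤ.1ℤ ℤ.- (+ p ℤ.+ (ℤ.1ℤ ℤ.+ + d))
    A≡ = cong (λ v → ℤ.1ℤ ℤ.- + v) (sym a≡)
    j≤Lp : j ≤ L p
    j≤Lp = j≤L p 1≤p (ℕP.≤-trans (ℕP.m≤m+n p (suc d)) (ℕP.≤-reflexive a≡))
    2+d≤a : 2 ℕ.+ d ≤ a
    2+d≤a = ℕP.≤-trans (ℕP.+-monoˡ-≤ (suc d) 1≤p) (ℕP.≤-reflexive a≡)
    E : ℕ
    E = L p ∸ j
    leg-left-comm : (leg d ++ left p) ≈ (left p ++ leg d)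
    leg-left-comm = stepUp-stepDown-comm d j' (+ j' ℤ.- + p) A (suc d)
      (trans (gap (+ j') (+ p) (+ d)) (cong (ℤ._+ + (suc d ℕ.+ j')) (sym A≡))) (ℕP.n<1+n d)
      (ℕP.≤-trans (ℕP.+-mono-≤ 2+d≤a (ℕP.≤-trans (ℕP.n≤1+n j') (ℕP.≤-trans j≤Lp (L≤c p)))) a+c≤n)
      where
      gap : ∀ x q z → x ℤ.- q ℤ.+ ℤ.1ℤ ≡ (ℤ.1ℤ ℤ.- (q ℤ.+ (ℤ.1ℤ ℤ.+ z))) ℤ.+ ((ℤ.1ℤ ℤ.+ z) ℤ.+ x)
      gap = solve-∀
    leg-right-comm : (leg d ++ right p) ≈ (right p ++ leg d)
    leg-right-comm rewrite right-form p j≤Lp =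
      stepUp-stepDown-comm d E (+ (j ℕ.+ E) ℤ.- + p) A (suc d ℕ.+ j)
        (trans (gap (+ j') (+ E) (+ p) (+ d)) (cong (ℤ._+ + (suc d ℕ.+ j ℕ.+ E)) (sym A≡)))
        (s≤s (ℕP.m≤m+n d j))
        (ℕP.≤-trans (ℕP.≤-reflexive (cong suc (ℕP.+-assoc (suc d) j E)))
          (ℕP.≤-trans (ℕP.+-mono-≤ 2+d≤a (ℕP.≤-trans (ℕP.≤-reflexive (sym (L≡j+[L∸j] p j≤Lp))) (L≤c p))) a+c≤n))
      where
      gap : ∀ x e q z → ℤ.1ℤ ℤ.+ x ℤ.+ e ℤ.- q ℤ.+ ℤ.1ℤ ≡ (ℤ.1ℤ ℤ.- (q ℤ.+ (ℤ.1ℤ ℤ.+ z))) ℤ.+ (((ℤ.1ℤ ℤ.+ z) ℤ.+ (ℤ.1ℤ ℤ.+ x)) ℤ.+ e)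
      gap = solve-∀

  hole-slide : ∀ d i' → suc i' ℕ.+ d ≡ a →
               (rows R (suc i') d ++ (right (suc i') ++ left (suc i'))) ≈ (rows slid i' (suc d) ++ (right (suc i') ++ leg d))
  hole-slide zero i' a≡ = begin
    right i ++ left i                             ≈⟨ right-left-comm i (j≤L i (s≤s z≤n) (ℕP.≤-reflexive i≡a)) ⟩
    left i ++ right i                             ≡⟨ cong₂ _++_ (sym (++-identityʳ (left i))) (sym (++-identityʳ (right i))) ⟩
    (left i ++ []) ++ (right i ++ [])             ≡⟨ cong (λ x → ((x ++ left i) ++ []) ++ (right i ++ [])) (sym (right-empty (suc i) L[1+i]≤j)) ⟩
    ((right (suc i) ++ left i) ++ []) ++ (right i ++ []) ∎
    where
    open ≈-Reasoning
    i : ℕ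
    i = suc i'
    i≡a : i ≡ a
    i≡a = trans (sym (ℕP.+-identityʳ i)) a≡
    L[1+i]≤j : L (suc i) ≤ j
    L[1+i]≤j = subst (λ v → L (suc v) ≤ j) (sym i≡a) L[1+a]≤j
  hole-slide (suc d) i' a≡ = begin
    rows R i (suc d) ++ (right i ++ left i)
      ≡⟨ cong (_++ (right i ++ left i)) (rows-peel R i d) ⟩
    (rows R (suc i) d ++ R (suc i)) ++ (right i ++ left i)
      ≡⟨ ++-assoc (rows R (suc i) d) (R (suc i)) (right i ++ left i) ⟩
    rows R (suc i) d ++ (R (suc i) ++ (right i ++ left i))
      ≈⟨ ++-congˡ (rows R (suc i) d) (hole-down i (s≤s z≤n) (ℕP.≤-trans (ℕP.m≤m+n (suc i) d) (ℕP.≤-reflexive a≡′))) ⟩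
    rows R (suc i) d ++ ((right (suc i) ++ left (suc i)) ++ W)
      ≡⟨ ++-assoc (rows R (suc i) d) (right (suc i) ++ left (suc i)) W ⟨
    (rows R (suc i) d ++ (right (suc i) ++ left (suc i))) ++ W
      ≈⟨ ++-congʳ W (hole-slide d i a≡′) ⟩
    (rows slid i (suc d) ++ (right (suc i) ++ leg d)) ++ W
      ≈⟨ solve 6 (λ S U₁ G V U X → (S ⊕ (U₁ ⊕ G)) ⊕ (V ⊕ U ⊕ X) ⊜ S ⊕ U₁ ⊕ ((G ⊕ (V ⊕ U)) ⊕ X)) ≈-refl
           (rows slid i (suc d)) (right (suc i)) (leg d) (left i) (right i) [ u ] ⟩
    rows slid i (suc d) ++ (right (suc i) ++ ((leg d ++ (left i ++ right i)) ++ [ u ]))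
      ≈⟨ ++-congˡ (rows slid i (suc d)) (++-congˡ (right (suc i)) (++-congʳ [ u ] (leg-comm i d (s≤s z≤n) a≡))) ⟩
    rows slid i (suc d) ++ (right (suc i) ++ (((left i ++ right i) ++ leg d) ++ [ u ]))
      ≈⟨ solve 6 (λ S U₁ V U G X → S ⊕ U₁ ⊕ ((V ⊕ U) ⊕ G) ⊕ X ⊜ (S ⊕ (U₁ ⊕ V)) ⊕ (U ⊕ (G ⊕ X))) ≈-refl
           (rows slid i (suc d)) (right (suc i)) (left i) (right i) (leg d) [ u ] ⟩
    (rows slid i (suc d) ++ slid i) ++ (right i ++ (leg d ++ [ u ]))
      ≡⟨ cong₂ (λ x y → x ++ (right i ++ y)) (sym (rows-peel slid i' (suc d))) (sym leg-∷ʳ) ⟩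
    rows slid i' (suc (suc d)) ++ (right i ++ leg (suc d)) ∎
    where
    open ≈-Reasoning
    open ++-Solver using (solve; _⊜_; _⊕_)
    i : ℕ
    i = suc i'
    u : ℤ
    u = ℤ.- + i
    W : List ℤ
    W = left i ++ (right i ++ [ u ])
    a≡′ : suc i ℕ.+ d ≡ a
    a≡′ = trans (sym (ℕP.+-suc i d)) a≡
    leg-∷ʳ : leg (suc d) ≡ leg d ++ [ u ]
    leg-∷ʳ = trans (stepUp-∷ʳ d (ℤ.1ℤ ℤ.- + a))
      (cong (λ v → leg d ++ [ v ]) (trans (cong (λ v → ℤ.1ℤ ℤ.- + v ℤ.+ + d) (sym a≡)) (last (+ i) (+ d))))
      where
      last : ∀ x z → ℤ.1ℤ ℤ.- (x ℤ.+ (ℤ.1ℤ ℤ.+ z)) ℤ.+ z ≡ ℤ.- x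
      last = solve-∀

  arm-through-top : ∀ i y → 1 ≤ i → i ≤ a → y < i →
                    (topRows R y ++ stepDown (+ L i ℤ.- ℤ.1ℤ) (L i ∸ j)) ≈ (stepDown (+ L i ℤ.- + suc y) (L i ∸ j) ++ topRows R y)
  arm-through-top i zero    _   _   _   = ≡⇒≈ (sym (++-identityʳ _))
  arm-through-top i (suc y) 1≤i i≤a y<i = begin
    (R p ++ topRows R y) ++ arm 1
      ≡⟨ ++-assoc (R p) (topRows R y) (arm 1) ⟩
    R p ++ (topRows R y ++ arm 1)
      ≈⟨ ++-congˡ (R p) (arm-through-top i y 1≤i i≤a (ℕP.<-trans (ℕP.n<1+n y) y<i)) ⟩
    R p ++ (arm p ++ topRows R y)
      ≡⟨ ++-assoc (R p) (arm p) (topRows R y) ⟨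
    (R p ++ arm p) ++ topRows R y
      ≈⟨ ++-congʳ (topRows R y) (stepDown-through-stepDown ℓ (L p) (+ L p ℤ.- + p) (L p ∸ L i) (+ L i ℤ.- + p) top≡ e+ℓ<Lp Lp<n) ⟩
    (stepDown (+ L i ℤ.- + p ℤ.- ℤ.1ℤ) ℓ ++ R p) ++ topRows R y
                                            ≡⟨ trans (++-assoc _ (R p) (topRows R y)) (cong (λ v → stepDown v ℓ ++ (R p ++ topRows R y)) (sub-suc (+ L i) (+ p))) ⟩
    arm (suc p) ++ (R p ++ topRows R y)     ∎
    where
    open ≈-Reasoning
    p ℓ : ℕ
    p = suc y
    ℓ = L i ∸ j
    arm : ℕ → List ℤ
    arm q = stepDown (+ L i ℤ.- + q) ℓ
    j≤Li : j ≤ L i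
    j≤Li = j≤L i 1≤i i≤a
    Li≤Lp : L i ≤ L p
    Li≤Lp = L-antitone p i (s≤s z≤n) (ℕP.<⇒≤ y<i)
    Lp<n : L p < n
    Lp<n = s≤s (ℕP.≤-trans (L≤c p) c≤k)
    e+ℓ<Lp : (L p ∸ L i) ℕ.+ ℓ < L p
    e+ℓ<Lp = subst (_< L p) (sym (∸-+-∸ j≤Li Li≤Lp))
               (ℕP.∸-monoʳ-< {o = 0} (s≤s z≤n) (ℕP.≤-trans j≤Li Li≤Lp))
    sub-suc : ∀ x q → x ℤ.- q ℤ.- ℤ.1ℤ ≡ x ℤ.- (ℤ.1ℤ ℤ.+ q)
    sub-suc = solve-∀
    top≡ : + L i ℤ.- + p ≡ + L p ℤ.- + p ℤ.- + (L p ∸ L i)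
    top≡ = trans (shift (+ L i) (+ L p) (+ p)) (cong (λ v → + L p ℤ.- + p ℤ.- v) (sym (pos-∸ Li≤Lp)))
      where
      shift : ∀ x y q → x ℤ.- q ≡ y ℤ.- q ℤ.- (y ℤ.- x)
      shift = solve-∀

  leg-comm-top : ∀ d y → y ℕ.+ suc d ≤ a → (topRows R y ++ leg d) ≈ (leg d ++ topRows R y)
  leg-comm-top d zero    _ = ≡⇒≈ (sym (++-identityʳ (leg d)))
  leg-comm-top d (suc y) h = begin
    (R p ++ topRows R y) ++ leg d   ≡⟨ ++-assoc (R p) (topRows R y) (leg d) ⟩
    R p ++ (topRows R y ++ leg d)   ≈⟨ ++-congˡ (R p) (leg-comm-top d y (ℕP.<⇒≤ h)) ⟩
    R p ++ (leg d ++ topRows R y)   ≡⟨ ++-assoc (R p) (leg d) (topRows R y) ⟨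
    (R p ++ leg d) ++ topRows R y   ≈⟨ ++-congʳ (topRows R y) leg-R-comm ⟨
    (leg d ++ R p) ++ topRows R y   ≡⟨ ++-assoc (leg d) (R p) (topRows R y) ⟩
    leg d ++ (R p ++ topRows R y)   ∎
    where
    open ≈-Reasoning
    p g : ℕ
    p = suc y
    g = a ∸ p
    a≡ : a ≡ p ℕ.+ g
    a≡ = sym (ℕP.m+[n∸m]≡n (ℕP.≤-trans (ℕP.m≤m+n p (suc d)) h))
    leg-R-comm : (leg d ++ R p) ≈ (R p ++ leg d)
    leg-R-comm = stepUp-stepDown-comm d (L p) (+ L p ℤ.- + p) (ℤ.1ℤ ℤ.- + a) g
      (trans (gap (+ L p) (+ p) (+ g)) (cong (λ v → ℤ.1ℤ ℤ.- + v ℤ.+ + (g ℕ.+ L p)) (sym a≡)))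
      (ℕP.+-cancelˡ-≤ p (suc d) g (ℕP.≤-trans h (ℕP.≤-reflexive a≡)))
      g+Lp<n
      where
      g+Lp<n : g ℕ.+ L p < n
      g+Lp<n = ℕP.≤-trans (ℕP.+-monoˡ-≤ (g ℕ.+ L p) (s≤s (z≤n {y})))
        (ℕP.≤-trans (ℕP.≤-reflexive (sym (ℕP.+-assoc p g (L p))))
        (ℕP.≤-trans (ℕP.+-monoʳ-≤ (p ℕ.+ g) (L≤c p))
        (ℕP.≤-trans (ℕP.≤-reflexive (cong (ℕ._+ c) (sym a≡))) a+c≤n)))
      gap : ∀ x q z → x ℤ.- q ℤ.+ ℤ.1ℤ ≡ (ℤ.1ℤ ℤ.- (q ℤ.+ z)) ℤ.+ (z ℤ.+ x)
      gap = solve-∀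

  hook-rows : ∀ i' d → suc i' ℕ.+ d ≡ a →
              ((rows R (suc i') d ++ (right (suc i') ++ left (suc i'))) ++ topRows R i')
                ≈ ((rows slid i' (suc d) ++ topRows R i') ++ (stepDown (+ L (suc i') ℤ.- ℤ.1ℤ) (L (suc i') ∸ j) ++ leg d))
  hook-rows i' d a≡ = ≈-sym (begin
    (Q ++ W) ++ (arm ++ leg d)        ≈⟨ solve 4 (λ Q W Γ₁ Γ₂ → (Q ⊕ W) ⊕ (Γ₁ ⊕ Γ₂) ⊜ Q ⊕ ((W ⊕ Γ₁) ⊕ Γ₂)) ≈-refl Q W arm (leg d) ⟩
    Q ++ ((W ++ arm) ++ leg d)        ≈⟨ ++-congˡ Q (++-congʳ (leg d) (arm-through-top i i' (s≤s z≤n) i≤a (ℕP.n<1+n i'))) ⟩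
    Q ++ ((right i ++ W) ++ leg d)    ≈⟨ ++-congˡ Q (≡⇒≈ (++-assoc (right i) W (leg d))) ⟩
    Q ++ (right i ++ (W ++ leg d))    ≈⟨ ++-congˡ Q (++-congˡ (right i) (leg-comm-top d i' (ℕP.≤-reflexive (trans (ℕP.+-suc i' d) a≡)))) ⟩
    Q ++ (right i ++ (leg d ++ W))    ≈⟨ solve 4 (λ Q U G W → Q ⊕ (U ⊕ (G ⊕ W)) ⊜ (Q ⊕ (U ⊕ G)) ⊕ W) ≈-refl Q (right i) (leg d) W ⟩
    (Q ++ (right i ++ leg d)) ++ W    ≈⟨ ++-congʳ W (hole-slide d i' a≡) ⟨
    (rows R i d ++ (right i ++ left i)) ++ W ∎)
    where
    open ≈-Reasoning
    open ++-Solver using (solve; _⊜_; _⊕_)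
    i : ℕ
    i = suc i'
    i≤a : i ≤ a
    i≤a = ℕP.≤-trans (ℕP.m≤m+n i d) (ℕP.≤-reflexive a≡)
    Q W arm : List ℤ
    Q = rows slid i' (suc d)
    W = topRows R i'
    arm = stepDown (+ L i ℤ.- ℤ.1ℤ) (L i ∸ j)

T⇒≡true : ∀ {b} → T b → b ≡ true
T⇒≡true = Equivalence.to T-≡

¬T⇒≡false : ∀ {b} → ¬ T b → b ≡ false
¬T⇒≡false ¬b = ¬-not (λ b≡true → ¬b (Equivalence.from T-≡ b≡true))

≤ᵇ-true : ∀ {x y} → x ≤ y → (x ℕ.≤ᵇ y) ≡ true
≤ᵇ-true x≤y = T⇒≡true (ℕP.≤⇒≤ᵇ x≤y)

≤ᵇ-false : ∀ {x y} → y < x → (x ℕ.≤ᵇ y) ≡ false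
≤ᵇ-false {x} {y} y<x = ¬T⇒≡false (λ t → ℕP.<⇒≱ y<x (ℕP.≤ᵇ⇒≤ x y t))

<ᵇ-true : ∀ {x y} → x < y → (x ℕ.<ᵇ y) ≡ true
<ᵇ-true x<y = T⇒≡true (ℕP.<⇒<ᵇ x<y)

<ᵇ-false : ∀ {x y} → y ≤ x → (x ℕ.<ᵇ y) ≡ false
<ᵇ-false {x} {y} y≤x = ¬T⇒≡false (λ t → ℕP.≤⇒≯ y≤x (ℕP.<ᵇ⇒< x y t))

≡ᵇ-refl : ∀ x → (x ℕ.≡ᵇ x) ≡ true
≡ᵇ-refl x = T⇒≡true (ℕP.≡⇒≡ᵇ x x refl)

≡ᵇ-false : ∀ {x y} → x ≢ y → (x ℕ.≡ᵇ y) ≡ false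
≡ᵇ-false {x} {y} x≢y = ¬T⇒≡false (λ t → x≢y (ℕP.≡ᵇ⇒≡ x y t))

ℤ≤ᵇ-true : ∀ {x y} → x ℤ.≤ y → (x ℤ.≤ᵇ y) ≡ true
ℤ≤ᵇ-true x≤y = T⇒≡true (ℤP.≤⇒≤ᵇ x≤y)

ℤ≤ᵇ-false : ∀ {x y} → y ℤ.< x → (x ℤ.≤ᵇ y) ≡ false
ℤ≤ᵇ-false y<x = ¬T⇒≡false (λ t → ℤP.<⇒≱ y<x (ℤP.≤ᵇ⇒≤ t))

row≤ : ∀ {c} la → All (_≤ c) la → ∀ p → row la p ≤ c
row≤ la       _        zero          = z≤n
row≤ []       _        (suc p)       = z≤n
row≤ (x ∷ la) (x≤ ∷ _) (suc zero)    = x≤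
row≤ (x ∷ la) (_ ∷ la≤) (suc (suc p)) = row≤ la la≤ (suc p)

row≤head : ∀ x la → Linked _≥_ (x ∷ la) → ∀ p → row la p ≤ x
row≤head x la       _             zero          = z≤n
row≤head x []       _             (suc p)       = z≤n
row≤head x (y ∷ la) (y≤x ∷ _)     (suc zero)    = y≤x
row≤head x (y ∷ la) (y≤x ∷ sorted) (suc (suc p)) = ℕP.≤-trans (row≤head y la sorted (suc p)) y≤x

row-antitone : ∀ la → Linked _≥_ la → ∀ p q → 1 ≤ p → p ≤ q → row la q ≤ row la p
row-antitone []       _      p             zero          _ _ = z≤n
row-antitone []       _      p             (suc q)       _ _ = z≤n
row-antitone (x ∷ la) _      (suc zero)    (suc zero)    _ _ = ℕP.≤-refl
row-antitone (x ∷ la) sorted (suc zero)    (suc (suc q)) _ _ = row≤head x la sorted (suc q)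
row-antitone (x ∷ la) sorted (suc (suc p)) (suc (suc q)) _ (s≤s p≤q) =
  row-antitone la (Linked.tail sorted) (suc p) (suc q) (s≤s z≤n) p≤q

conj-∷-≤ : ∀ {j x} la → j ≤ x → conj (x ∷ la) j ≡ suc (conj la j)
conj-∷-≤ {j} {x} la j≤x with j ℕ.≤ᵇ x in e
... | true  = refl
... | false = contradiction (trans (sym (≤ᵇ-true j≤x)) e) λ ()

conj-∷-> : ∀ {j x} la → x < j → conj (x ∷ la) j ≡ conj la j
conj-∷-> {j} {x} la x<j with j ℕ.≤ᵇ x in e
... | true  = contradiction (trans (sym (≤ᵇ-false x<j)) e) λ ()
... | false = refl

conj≡0 : ∀ j x la → Linked _≥_ (x ∷ la) → x < j → conj la j ≡ 0
conj≡0 j x []       _              _   = refl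
conj≡0 j x (y ∷ la) (y≤x ∷ sorted) x<j =
  trans (conj-∷-> la (ℕP.≤-<-trans y≤x x<j)) (conj≡0 j y la sorted (ℕP.≤-<-trans y≤x x<j))

≤conj⇒≤row : ∀ j la → Linked _≥_ la → ∀ p → 1 ≤ p → p ≤ conj la j → j ≤ row la p
≤conj⇒≤row j []       _      (suc p) _ ()
≤conj⇒≤row j (x ∷ la) sorted p 1≤p p≤ with j ℕ.≤? x
≤conj⇒≤row j (x ∷ la) sorted (suc zero)    _ _  | yes j≤x = j≤x
≤conj⇒≤row j (x ∷ la) sorted (suc (suc p)) _ p≤ | yes j≤x =
  ≤conj⇒≤row j la (Linked.tail sorted) (suc p) (s≤s z≤n) (ℕP.≤-pred (subst (suc (suc p) ≤_) (conj-∷-≤ la j≤x) p≤))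
... | no j≰x = contradiction (subst (p ≤_) (trans (conj-∷-> la x<j) (conj≡0 j x la sorted x<j)) p≤) (ℕP.<⇒≱ 1≤p)
  where
  x<j : x < j
  x<j = ℕP.≰⇒> j≰x

conj<⇒row< : ∀ j → 1 ≤ j → ∀ la → Linked _≥_ la → ∀ p → conj la j < p → row la p < j
conj<⇒row< j 1≤j []       _      (suc p) _ = 1≤j
conj<⇒row< j 1≤j (x ∷ la) sorted p conj< with j ℕ.≤? x
conj<⇒row< j 1≤j (x ∷ la) sorted (suc zero) conj< | yes j≤x =
  contradiction (s≤s z≤n) (ℕP.<⇒≱ (subst (_< 1) (conj-∷-≤ la j≤x) conj<))
conj<⇒row< j 1≤j (x ∷ la) sorted (suc (suc p)) conj< | yes j≤x =
  conj<⇒row< j 1≤j la (Linked.tail sorted) (suc p) (ℕP.≤-pred (subst (_< suc (suc p)) (conj-∷-≤ la j≤x) conj<))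
conj<⇒row< j 1≤j (x ∷ la) sorted (suc zero)    _ | no j≰x = ℕP.≰⇒> j≰x
conj<⇒row< j 1≤j (x ∷ la) sorted (suc (suc p)) _ | no j≰x = ℕP.≤-<-trans (row≤head x la sorted (suc p)) (ℕP.≰⇒> j≰x)

conj≤length : ∀ j la → conj la j ≤ length la
conj≤length j la = length-filter (j ℕ.≤?_) la

module Reading (k : ℕ) where

  open Residue k
  open Words k

  readRow-skip : ∀ D p m x → (∀ q → m < q → q ≤ x ℕ.+ m → D p q ≡ false) →
                 readRow k D p (x ℕ.+ m) ≡ readRow k D p m
  readRow-skip D p m zero    _ = refl
  readRow-skip D p m (suc x) absent rewrite absent (suc (x ℕ.+ m)) (s≤s (ℕP.m≤n+m m x)) ℕP.≤-refl =
    readRow-skip D p m x (λ q m<q q≤ → absent q m<q (ℕP.m≤n⇒m≤1+n q≤))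

  readRow-take : ∀ D p m x → (∀ q → m < q → q ≤ x ℕ.+ m → D p q ≡ true) →
                 readRow k D p (x ℕ.+ m) ≈ stepDown (+ (x ℕ.+ m) ℤ.- + p) x ++ readRow k D p m
  readRow-take D p m zero    _ = ≈-refl
  readRow-take D p m (suc x) present rewrite present (suc (x ℕ.+ m)) (s≤s (ℕP.m≤n+m m x)) ℕP.≤-refl =
    ∷-cong (res-idem (+ suc (x ℕ.+ m) ℤ.- + p))
      (≈-trans (readRow-take D p m x (λ q m<q q≤ → present q m<q (ℕP.m≤n⇒m≤1+n q≤)))
               (≡⇒≈ (cong (λ v → stepDown v x ++ readRow k D p m) (pred-top (+ (x ℕ.+ m)) (+ p)))))
    where
    pred-top : ∀ x q → x ℤ.- q ≡ ℤ.1ℤ ℤ.+ x ℤ.- q ℤ.- ℤ.1ℤ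
    pred-top = solve-∀

  readRow-cong : ∀ D D' p M → (∀ q → D p q ≡ D' p q) → readRow k D p M ≡ readRow k D' p M
  readRow-cong D D' p zero    _     = refl
  readRow-cong D D' p (suc M) D≡D' rewrite D≡D' (suc M) = cong (_ ++_) (readRow-cong D D' p M D≡D')

  readRow-diagOf : ∀ μ p M → 1 ≤ p → μ p ≤ M → readRow k (diagOf μ) p M ≈ rowWord μ p
  readRow-diagOf μ (suc p') M _ μp≤M = begin
    readRow k D p M                          ≡⟨ cong (readRow k D p) (sym (ℕP.m∸n+n≡m μp≤M)) ⟩
    readRow k D p ((M ∸ ℓ) ℕ.+ ℓ)            ≡⟨ readRow-skip D p ℓ (M ∸ ℓ) absent ⟩
    readRow k D p ℓ                          ≡⟨ cong (readRow k D p) (sym (ℕP.+-identityʳ ℓ)) ⟩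
    readRow k D p (ℓ ℕ.+ 0)                  ≈⟨ readRow-take D p 0 ℓ present ⟩
    stepDown (+ (ℓ ℕ.+ 0) ℤ.- + p) ℓ ++ []   ≡⟨ trans (++-identityʳ _) (cong (λ v → stepDown (+ v ℤ.- + p) ℓ) (ℕP.+-identityʳ ℓ)) ⟩
    rowWord μ p                              ∎
    where
    open ≈-Reasoning
    p ℓ : ℕ
    p = suc p'
    ℓ = μ p
    D : ℕ → ℕ → Bool
    D = diagOf μ
    absent : ∀ q → ℓ < q → q ≤ (M ∸ ℓ) ℕ.+ ℓ → D p q ≡ false
    absent (suc q) ℓ<q _ = ≤ᵇ-false ℓ<q
    present : ∀ q → 0 < q → q ≤ ℓ ℕ.+ 0 → D p q ≡ true
    present (suc q) _ q≤ = ≤ᵇ-true (ℕP.≤-trans q≤ (ℕP.≤-reflexive (ℕP.+-identityʳ ℓ)))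

  readRow-diagMinus : ∀ la i' j' M → suc j' ≤ row la (suc i') → row la (suc i') ≤ M →
                      readRow k (diagMinus la (suc i') (suc j')) (suc i') M
                        ≈ rightWord (row la) (suc j') (suc i') ++ leftWord j' (suc i')
  readRow-diagMinus la i' j' M j≤ℓ ℓ≤M = begin
    readRow k D i M
      ≡⟨ cong (readRow k D i) (sym (ℕP.m∸n+n≡m ℓ≤M)) ⟩
    readRow k D i ((M ∸ ℓ) ℕ.+ ℓ)
      ≡⟨ readRow-skip D i ℓ (M ∸ ℓ) right-of-row ⟩
    readRow k D i ℓ
      ≡⟨ cong (readRow k D i) (sym (ℕP.m∸n+n≡m j≤ℓ)) ⟩
    readRow k D i ((ℓ ∸ j) ℕ.+ j)
      ≈⟨ readRow-take D i j (ℓ ∸ j) right-of-hole ⟩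
    stepDown (+ ((ℓ ∸ j) ℕ.+ j) ℤ.- + i) (ℓ ∸ j) ++ readRow k D i (1 ℕ.+ j')
      ≡⟨ cong₂ (λ v w → stepDown (+ v ℤ.- + i) (ℓ ∸ j) ++ w) (ℕP.m∸n+n≡m j≤ℓ) (readRow-skip D i j' 1 hole) ⟩
    rightWord (row la) j i ++ readRow k D i j'
      ≡⟨ cong (λ v → rightWord (row la) j i ++ readRow k D i v) (sym (ℕP.+-identityʳ j')) ⟩
    rightWord (row la) j i ++ readRow k D i (j' ℕ.+ 0)
      ≈⟨ ++-congˡ (rightWord (row la) j i) (readRow-take D i 0 j' left-of-hole) ⟩
    rightWord (row la) j i ++ (stepDown (+ (j' ℕ.+ 0) ℤ.- + i) j' ++ [])
      ≡⟨ cong (rightWord (row la) j i ++_) (trans (++-identityʳ _) (cong (λ v → stepDown (+ v ℤ.- + i) j') (ℕP.+-identityʳ j'))) ⟩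
    rightWord (row la) j i ++ leftWord j' i ∎
    where
    open ≈-Reasoning
    i j ℓ : ℕ
    i = suc i'
    j = suc j'
    ℓ = row la i
    D : ℕ → ℕ → Bool
    D = diagMinus la i j
    D-row : ∀ q → D i q ≡ (diagOf (row la) i q ∧ not (q ℕ.≡ᵇ j))
    D-row q rewrite ≡ᵇ-refl i = refl
    right-of-row : ∀ q → ℓ < q → q ≤ (M ∸ ℓ) ℕ.+ ℓ → D i q ≡ false
    right-of-row (suc q) ℓ<q _ rewrite D-row (suc q) | ≤ᵇ-false {suc q} {ℓ} ℓ<q = refl
    right-of-hole : ∀ q → j < q → q ≤ (ℓ ∸ j) ℕ.+ j → D i q ≡ true
    right-of-hole (suc q) j<q q≤ rewrite D-row (suc q) | ≤ᵇ-true {suc q} {ℓ} (ℕP.≤-trans q≤ (ℕP.≤-reflexive (ℕP.m∸n+n≡m j≤ℓ)))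
                                       | ≡ᵇ-false (λ e → ℕP.<-irrefl (sym e) j<q) = refl
    hole : ∀ q → j' < q → q ≤ 1 ℕ.+ j' → D i q ≡ false
    hole (suc q) (s≤s j'≤q) (s≤s q≤j') with ℕP.≤-antisym q≤j' j'≤q
    ... | refl rewrite D-row j | ≤ᵇ-true {j} {ℓ} j≤ℓ | ≡ᵇ-refl j = refl
    left-of-hole : ∀ q → 0 < q → q ≤ j' ℕ.+ 0 → D i q ≡ true
    left-of-hole (suc q) _ q≤ rewrite ℕP.+-identityʳ j' | D-row (suc q) | ≤ᵇ-true {suc q} {ℓ} (ℕP.≤-trans q≤ (ℕP.≤-trans (ℕP.n≤1+n j') j≤ℓ))
                                    | ≡ᵇ-false (λ e → ℕP.<-irrefl e (s≤s q≤)) = refl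

private
  diff-suc : ∀ x y t → x ℤ.+ ℤ.1ℤ ≡ y ℤ.+ + suc t → x ℤ.- y ≡ + t
  diff-suc x y t e = trans (expand x y) (trans (cong (λ v → v ℤ.- y ℤ.- ℤ.1ℤ) e) (collapse y (+ t)))
    where
    expand : ∀ x y → x ℤ.- y ≡ x ℤ.+ ℤ.1ℤ ℤ.- y ℤ.- ℤ.1ℤ
    expand = solve-∀
    collapse : ∀ y z → y ℤ.+ (ℤ.1ℤ ℤ.+ z) ℤ.- y ℤ.- ℤ.1ℤ ≡ z
    collapse = solve-∀

  diff≡⇒≤ : ∀ x y t → x ℤ.- y ≡ + t → y ℤ.≤ x
  diff≡⇒≤ x y t e = subst (y ℤ.≤_) (trans (ℤP.+-comm y (+ t)) (trans (cong (ℤ._+ y) (sym e)) (cancel x y))) (ℤP.i≤i+j y (+ t))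
    where
    cancel : ∀ x y → x ℤ.- y ℤ.+ y ≡ x
    cancel = solve-∀

  suc≡⇒< : ∀ x y → x ℤ.+ ℤ.1ℤ ≡ y ℤ.+ + 0 → x ℤ.< y
  suc≡⇒< x y e = ℤP.suc[i]≤j⇒i<j (ℤP.≤-reflexive (trans (ℤP.+-comm ℤ.1ℤ x) (trans e (ℤP.+-identityʳ y))))

rangeDown≡stepDown : ∀ x y t → x ℤ.+ ℤ.1ℤ ≡ y ℤ.+ + t → rangeDown x y ≡ stepDown x t
rangeDown≡stepDown x y zero    e rewrite ℤ≤ᵇ-false (suc≡⇒< x y e) = refl
rangeDown≡stepDown x y (suc t) e rewrite ℤ≤ᵇ-true (diff≡⇒≤ x y t (diff-suc x y t e)) | diff-suc x y t e = refl

rangeUp≡stepUp : ∀ x y t → y ℤ.+ ℤ.1ℤ ≡ x ℤ.+ + t → rangeUp x y ≡ stepUp x t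
rangeUp≡stepUp x y zero    e rewrite ℤ≤ᵇ-false (suc≡⇒< y x e) = refl
rangeUp≡stepUp x y (suc t) e rewrite ℤ≤ᵇ-true (diff≡⇒≤ y x t (diff-suc y x t e)) | diff-suc y x t e = refl

readDiag-+ : ∀ k D M x y → readDiag k D (x ℕ.+ y) M ≡ rows (λ p → readRow k D p M) y x ++ readDiag k D y M
readDiag-+ k D M zero    y = refl
readDiag-+ k D M (suc x) y = trans (cong (readRow k D (suc (x ℕ.+ y)) M ++_) (readDiag-+ k D M x y))
                                   (sym (++-assoc (readRow k D (suc (x ℕ.+ y)) M) _ _))

readDiag≡topRows : ∀ k D M y → readDiag k D y M ≡ topRows (λ p → readRow k D p M) y
readDiag≡topRows k D M zero    = refl
readDiag≡topRows k D M (suc y) = cong (readRow k D (suc y) M ++_) (readDiag≡topRows k D M y)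

module Hook (k c : ℕ) (c≤k : c ≤ k) (la : List ℕ) (sorted : Linked _≥_ la)
            (short : length la ≤ suc k ∸ c) (narrow : All (_≤ c) la)
            (i' j' : ℕ) (j≤λi : suc j' ≤ row la (suc i')) where

  open Residue k using (n)
  open Words k
  open Reading k

  i j a N d t : ℕ
  i = suc i'
  j = suc j'
  a = conj la j
  N = suc k ∸ c
  d = a ∸ i
  t = N ∸ a

  L : ℕ → ℕ
  L = row la

  Dm Dx : ℕ → ℕ → Bool
  Dm = diagMinus la i j
  Dx = diagOf (rowLx la i j)

  L≤c : ∀ p → L p ≤ c
  L≤c = row≤ la narrow

  L<j : ∀ p → a < p → L p < j
  L<j = conj<⇒row< j (s≤s z≤n) la sorted

  j≤L : ∀ p → 1 ≤ p → p ≤ a → j ≤ L p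
  j≤L = ≤conj⇒≤row j la sorted

  i≤a : i ≤ a
  i≤a = ℕP.≮⇒≥ (λ a<i → ℕP.<⇒≱ (L<j i a<i) j≤λi)

  a≡ : suc i' ℕ.+ d ≡ a
  a≡ = ℕP.m+[n∸m]≡n i≤a

  a≤N : a ≤ N
  a≤N = ℕP.≤-trans (conj≤length j la) short

  a+c≤n : a ℕ.+ c ≤ n
  a+c≤n = ℕP.≤-trans (ℕP.+-monoˡ-≤ c a≤N) (ℕP.≤-reflexive (ℕP.m∸n+n≡m (ℕP.m≤n⇒m≤1+n c≤k)))

  open Rows k c c≤k L L≤c (row-antitone la sorted) j' a a+c≤n j≤L (ℕP.<⇒≤ (L<j (suc a) ℕP.≤-refl))
    hiding (j)

  readDiag-bands : ∀ D → readDiag k D N c ≡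
    rows (λ p → readRow k D p c) a t ++ (rows (λ p → readRow k D p c) i' (suc d) ++ topRows (λ p → readRow k D p c) i')
  readDiag-bands D = begin
    readDiag k D N c                             ≡⟨ cong (λ v → readDiag k D v c) (sym (ℕP.m∸n+n≡m a≤N)) ⟩
    readDiag k D (t ℕ.+ a) c                     ≡⟨ readDiag-+ k D c t a ⟩
    rows F a t ++ readDiag k D a c               ≡⟨ cong (λ v → rows F a t ++ readDiag k D v c) (trans (sym a≡) (cong suc (ℕP.+-comm i' d))) ⟩
    rows F a t ++ readDiag k D (suc d ℕ.+ i') c  ≡⟨ cong (rows F a t ++_) (readDiag-+ k D c (suc d) i') ⟩
    rows F a t ++ (rows F i' (suc d) ++ readDiag k D i' c) ≡⟨ cong (λ v → rows F a t ++ (rows F i' (suc d) ++ v)) (readDiag≡topRows k D c i') ⟩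
    rows F a t ++ (rows F i' (suc d) ++ topRows F i') ∎
    where
    open ≡-Reasoning
    F : ℕ → List ℤ
    F p = readRow k D p c

  Dm-row : ∀ p → p ≢ i → 1 ≤ p → readRow k Dm p c ≈ R p
  Dm-row p p≢i 1≤p = ≈-trans (≡⇒≈ (readRow-cong Dm (diagOf L) p c unchanged)) (readRow-diagOf L p c 1≤p (L≤c p))
    where
    unchanged : ∀ q → Dm p q ≡ diagOf L p q
    unchanged q rewrite ≡ᵇ-false p≢i = ∧-identityʳ (diagOf L p q)

  rowLx≡L : ∀ p → p < i ⊎ a < p → rowLx la i j p ≡ L p
  rowLx≡L p (inj₁ p<i) rewrite <ᵇ-true p<i = refl
  rowLx≡L p (inj₂ a<p) rewrite <ᵇ-false (ℕP.<⇒≤ (ℕP.≤-<-trans i≤a a<p))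
                             | ℕP.m≤n⇒m⊓n≡m (ℕP.≤-pred (L<j p a<p))
                             | ℕP.m≤n⇒m∸n≡0 (ℕP.<⇒≤ (L<j (suc p) (ℕP.m<n⇒m<1+n a<p))) = ℕP.+-identityʳ (L p)

  Dx-row : ∀ p → 1 ≤ p → p < i ⊎ a < p → readRow k Dx p c ≈ R p
  Dx-row p 1≤p outside = ≈-trans (≡⇒≈ (readRow-cong Dx (diagOf L) p c unchanged)) (readRow-diagOf L p c 1≤p (L≤c p))
    where
    unchanged : ∀ q → Dx p q ≡ diagOf L p q
    unchanged q = cong (λ v → (1 ℕ.≤ᵇ p) ∧ (1 ℕ.≤ᵇ q) ∧ (q ℕ.≤ᵇ v)) (rowLx≡L p outside)

  rowLx-hook : ∀ p → i ≤ p → p ≤ a → rowLx la i j p ≡ j' ℕ.+ (L (suc p) ∸ j)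
  rowLx-hook p i≤p p≤a rewrite <ᵇ-false i≤p | ℕP.m≥n⇒m⊓n≡n (ℕP.≤-trans (ℕP.n≤1+n j') (j≤L p (ℕP.≤-trans (s≤s z≤n) i≤p) p≤a)) = refl

  right-suc : ∀ p → stepDown (+ (j' ℕ.+ (L (suc p) ∸ j)) ℤ.- + p) (L (suc p) ∸ j) ≡ right (suc p)
  right-suc p with j ℕ.≤? L (suc p)
  ... | yes j≤ = cong (λ v → stepDown v (L (suc p) ∸ j))
                   (trans (shift (+ j') (+ (L (suc p) ∸ j)) (+ p)) (cong (λ v → + v ℤ.- + suc p) (ℕP.m+[n∸m]≡n j≤)))
    where
    shift : ∀ x e q → x ℤ.+ e ℤ.- q ≡ ℤ.1ℤ ℤ.+ x ℤ.+ e ℤ.- (ℤ.1ℤ ℤ.+ q)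
    shift = solve-∀
  ... | no j≰ = trans (cong (stepDown _) E≡0) (cong (stepDown _) (sym E≡0))
    where
    E≡0 : L (suc p) ∸ j ≡ 0
    E≡0 = ℕP.m≤n⇒m∸n≡0 (ℕP.<⇒≤ (ℕP.≰⇒> j≰))

  rowWord-rowLx : ∀ p → i ≤ p → p ≤ a → rowWord (rowLx la i j) p ≡ slid p
  rowWord-rowLx p i≤p p≤a = begin
    rowWord (rowLx la i j) p                  ≡⟨ cong (λ v → stepDown (+ v ℤ.- + p) v) (rowLx-hook p i≤p p≤a) ⟩
    stepDown b (j' ℕ.+ E)                     ≡⟨ cong (stepDown b) (ℕP.+-comm j' E) ⟩
    stepDown b (E ℕ.+ j')                     ≡⟨ stepDown-++ E j' b ⟩
    stepDown b E ++ stepDown (b ℤ.- + E) j'   ≡⟨ cong₂ _++_ (right-suc p) (cong (λ v → stepDown v j') (cancel (+ j') (+ E) (+ p))) ⟩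
    right (suc p) ++ left p                   ∎
    where
    open ≡-Reasoning
    E : ℕ
    E = L (suc p) ∸ j
    b : ℤ
    b = + (j' ℕ.+ E) ℤ.- + p
    cancel : ∀ x e q → x ℤ.+ e ℤ.- q ℤ.- e ≡ x ℤ.- q
    cancel = solve-∀

  Dx-hook-row : ∀ p → i ≤ p → p ≤ a → readRow k Dx p c ≈ slid p
  Dx-hook-row p i≤p p≤a = ≈-trans (readRow-diagOf (rowLx la i j) p c (ℕP.≤-trans (s≤s z≤n) i≤p) rowLx≤c)
                                  (≡⇒≈ (rowWord-rowLx p i≤p p≤a))
    where
    j≤c : j ≤ c
    j≤c = ℕP.≤-trans (j≤L p (ℕP.≤-trans (s≤s z≤n) i≤p) p≤a) (L≤c p)
    rowLx≤c : rowLx la i j p ≤ c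
    rowLx≤c = ℕP.≤-trans (ℕP.≤-reflexive (rowLx-hook p i≤p p≤a))
                (ℕP.≤-trans (ℕP.+-monoʳ-≤ j' (ℕP.∸-monoˡ-≤ j (L≤c (suc p))))
                (ℕP.≤-trans (ℕP.n≤1+n _) (ℕP.≤-reflexive (ℕP.m+[n∸m]≡n j≤c))))

  Γword≡arm++leg : Γword la i j ≡ stepDown (+ L i ℤ.- ℤ.1ℤ) (L i ∸ j) ++ leg d
  Γword≡arm++leg = cong₂ _++_
    (rangeDown≡stepDown _ _ (L i ∸ j) (trans (pred-suc (+ L i)) (cong +_ (sym (ℕP.m+[n∸m]≡n j≤λi)))))
    (trans (rangeUp≡stepUp _ _ d (trans (split (+ i) (+ d)) (cong (λ v → ℤ.- + v ℤ.+ ℤ.1ℤ ℤ.+ + d) a≡)))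
           (cong (λ v → stepUp v d) (neg-suc (+ a))))
    where
    pred-suc : ∀ x → x ℤ.- ℤ.1ℤ ℤ.+ ℤ.1ℤ ≡ x
    pred-suc = solve-∀
    split : ∀ x z → ℤ.- x ℤ.+ ℤ.1ℤ ≡ ℤ.- (x ℤ.+ z) ℤ.+ ℤ.1ℤ ℤ.+ z
    split = solve-∀
    neg-suc : ∀ x → ℤ.- x ℤ.+ ℤ.1ℤ ≡ ℤ.1ℤ ℤ.- x
    neg-suc = solve-∀

  readDiag-Dm : readDiag k Dm N c ≈ rows R a t ++ ((rows R i d ++ (right i ++ left i)) ++ topRows R i')
  readDiag-Dm = ≈-trans (≡⇒≈ (readDiag-bands Dm)) (++-cong
    (rows-cong F R a t λ p a<p _ → Dm-row p (λ p≡i → ℕP.<-irrefl (sym p≡i) (ℕP.≤-<-trans i≤a a<p)) (ℕP.≤-trans (s≤s z≤n) a<p))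
    (++-cong (≈-trans (≡⇒≈ (rows-peel F i' d))
               (++-cong (rows-cong F R i d λ p i<p _ → Dm-row p (λ p≡i → ℕP.<-irrefl (sym p≡i) i<p) (ℕP.≤-trans (s≤s z≤n) i<p))
                        (readRow-diagMinus la i' j' c j≤λi (L≤c i))))
             (topRows-cong F R i' λ p 1≤p p≤i' → Dm-row p (λ p≡i → ℕP.<-irrefl p≡i (s≤s p≤i')) 1≤p)))
    where
    F : ℕ → List ℤ
    F p = readRow k Dm p c

  readDiag-Dx : readDiag k Dx N c ≈ rows R a t ++ (rows slid i' (suc d) ++ topRows R i')
  readDiag-Dx = ≈-trans (≡⇒≈ (readDiag-bands Dx)) (++-cong
    (rows-cong F R a t λ p a<p _ → Dx-row p (ℕP.≤-trans (s≤s z≤n) a<p) (inj₂ a<p))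
    (++-cong (rows-cong F slid i' (suc d) λ p i'<p p≤ → Dx-hook-row p i'<p (ℕP.≤-trans p≤ (ℕP.≤-reflexive (trans (cong suc (ℕP.+-comm d i')) a≡))))
             (topRows-cong F R i' λ p 1≤p p≤i' → Dx-row p 1≤p (inj₁ (s≤s p≤i')))))
    where
    F : ℕ → List ℤ
    F p = readRow k Dx p c

  readDiag-hook : readDiag k Dm N c ≈ (readDiag k Dx N c ++ Γword la i j)
  readDiag-hook = begin
    readDiag k Dm N c                                                   ≈⟨ readDiag-Dm ⟩
    rows R a t ++ ((rows R i d ++ (right i ++ left i)) ++ topRows R i') ≈⟨ ++-congˡ (rows R a t) (hook-rows i' d a≡) ⟩
    rows R a t ++ ((rows slid i' (suc d) ++ topRows R i') ++ (arm ++ leg d))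
      ≈⟨ solve 4 (λ X Q W Γ → X ⊕ ((Q ⊕ W) ⊕ Γ) ⊜ (X ⊕ (Q ⊕ W)) ⊕ Γ) ≈-refl (rows R a t) (rows slid i' (suc d)) (topRows R i') (arm ++ leg d) ⟩
    (rows R a t ++ (rows slid i' (suc d) ++ topRows R i')) ++ (arm ++ leg d)
      ≈⟨ ++-cong readDiag-Dx (≡⇒≈ Γword≡arm++leg) ⟨
    readDiag k Dx N c ++ Γword la i j                                   ∎
    where
    open ≈-Reasoning
    open ++-Solver using (solve; _⊜_; _⊕_)
    arm : List ℤ
    arm = stepDown (+ L i ℤ.- ℤ.1ℤ) (L i ∸ j)

lemma4p12 : (k : ℕ) → 1 ≤ k → (c : ℕ) → c ≤ k →
    (la : List ℕ) → Linked _≥_ la → All (1 ≤_) la →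
    length la ≤ suc k ∸ c → All (_≤ c) la →
    (i j : ℕ) → 1 ≤ i → 1 ≤ j → j ≤ row la i →
    (m : ℤ) →
    wDiag k (diagMinus la i j) (suc k ∸ c) c m
      ≡ wDiag k (diagOf (rowLx la i j)) (suc k ∸ c) c (act k (Γword la i j) m)
lemma4p12 k _ c c≤k la sorted _ short narrow (suc i') (suc j') _ _ j≤λi m = begin
  act k (readDiag k Dm N c) m                   ≡⟨ act-≡ (Hook.readDiag-hook k c c≤k la sorted short narrow i' j' j≤λi) m ⟩
  act k (readDiag k Dx N c ++ Γword la i j) m   ≡⟨ act-++ (readDiag k Dx N c) (Γword la i j) m ⟩
  act k (readDiag k Dx N c) (act k (Γword la i j) m) ∎
  where
  open ≡-Reasoning
  open Words k using (act-++; act-≡)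
  i j N : ℕ
  i = suc i'
  j = suc j'
  N = suc k ∸ c
  Dm Dx : ℕ → ℕ → Bool
  Dm = diagMinus la i j
  Dx = diagOf (rowLx la i j)
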